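{- Let $\Gamma \vdash V : A$ and $\Gamma \vdash W : A$ be value terms of $\lambda_{\mathrm{eff}}$ such that $[\![V]\!] = [\![W]\!]$ holds in every $\lambda_{\mathrm{eff}}$-model. Then $\Gamma \vdash V = W : A$ is derivable. Similar statements hold for computation terms and handlers.
   Context: The calculus $\lambda_{\mathrm{eff}}$ (fine-grain call-by-value with deep effect handlers). Value types $A ::= A \to C \mid \prod_{i=1}^n A_i$; computation types $C ::= A\,!\,\Sigma$; a signature $\Sigma$ is a finite set of entries $\mathtt{op} : A \to B$ (operation $\mathtt{op}$ with argument type $A$ and result type $B$; in a signature entry the arrow denotes an operation signature, not a function type); handler types $\Sigma \Rightarrow C$. Values $V ::= x \mid \lambda x.M \mid \langle V_1,\dots,V_n\rangle \mid \pi_i\,V$; computations $M ::= V\,W \mid \mathtt{return}\ V \mid \mathtt{let}\ x \Leftarrow M\ \mathtt{in}\ N \mid \mathtt{op}(V) \mid \mathtt{handle}\ M\ \mathtt{with}\ H\ \mathtt{to}\ x.\,N$; handlers $H ::= \emptyset \mid \{\mathtt{op}(x,k)\mapsto M\}\cup H$, where a handler $H:\Sigma\Rightarrow C$ has a clause $\Gamma,x:A_{\mathtt{op}},k:B_{\mathtt{op}}\to C\vdash M_{\mathtt{op}}:C$ for each $(\mathtt{op}:A_{\mathtt{op}}\to B_{\mathtt{op}})\in\Sigma$, and $\mathtt{handle}\ M\ \mathtt{with}\ H\ \mathtt{to}\ x.N : C$ requires $M : A!\Sigma$, $H:\Sigma\Rightarrow C$, $\Gamma,x:A\vdash N:C$.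 Equations: least congruence containing $\beta/\eta$ for functions and products, monad laws for $\mathtt{let}$, and $\mathtt{handle}\ \mathtt{return}\ V\ \mathtt{with}\ H\ \mathtt{to}\ x.M = M[V/x]$; $\mathtt{handle}\ (\mathtt{let}\ x\Leftarrow L\ \mathtt{in}\ M)\ \mathtt{with}\ H\ \mathtt{to}\ y.N = \mathtt{handle}\ L\ \mathtt{with}\ H\ \mathtt{to}\ x.(\mathtt{handle}\ M\ \mathtt{with}\ H\ \mathtt{to}\ y.N)$; $\mathtt{handle}\ \mathtt{op}(V)\ \mathtt{with}\ H\ \mathtt{to}\ x.M = M_{\mathtt{op}}[V/x,\lambda x.M/k]$. A $\lambda_{\mathrm{eff}}$-model: a cartesian category $\mathcal{C}$; strong monads $T_S$ indexed by semantic signatures $S$ (finite partial maps from operation symbols to pairs of objects) with Kleisli exponentials $(Y\Rightarrow_{T} Z)$ (defined by $\mathcal{C}_T(J(X\times Y),Z)\cong\mathcal{C}(X,Y\Rightarrow_T Z)$, with evaluation $\mathrm{ev}$); morphisms $[\![\mathtt{op}]\!]_S : A_{\mathtt{op}}\to T_S B_{\mathtt{op}}$; and $\mathrm{handle}_{S,S',X} : \mathcal{H}_S(X)\times T_S T_{S'}X\to T_{S'}X$, where $\mathcal{H}_S(X)=\prod_{(\mathtt{op}:A_{\mathtt{op}}\to B_{\mathtt{op}})\in S}((A_{\mathtt{op}}\times(B_{\mathtt{op}}\Rightarrow_{T_{S'}}X))\Rightarrow_{T_{S'}}X)$, satisfying $\mathrm{handle}\circ(\mathrm{id}\times\eta)=\pi_2$,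 $\mathrm{handle}\circ(\mathrm{id}\times\mu)=\mathrm{handle}\circ(\mathrm{id}\times T_S\mathrm{handle})\circ\langle\pi_1,\mathrm{st}\rangle$, and $\mathrm{handle}\circ(\mathrm{id}\times a_{\mathtt{op}})=\mathrm{ev}\circ(\pi_{\mathtt{op}}\times\mathrm{id})$ with $a_{\mathtt{op}}=T_S\mathrm{ev}\circ\mathrm{st}\circ\mathrm{swap}\circ([\![\mathtt{op}]\!]_S\times\mathrm{id})$. Terms are interpreted compositionally as in fine-grain call-by-value, with $[\![\mathtt{op}(V)]\!]=[\![\mathtt{op}]\!]\circ[\![V]\!]$, handlers as tuples of curried clauses, and $[\![\mathtt{handle}\ M\ \mathtt{with}\ H\ \mathtt{to}\ x.N]\!]=\mathrm{handle}\circ\langle[\![H]\!],T[\![N]\!]\circ\mathrm{st}\circ\langle\mathrm{id},[\![M]\!]\rangle\rangle$. -}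

module Defs where

open import Level using (0ℓ)
open import Data.Nat using (ℕ; suc; _+_)
open import Data.Product using (Σ-syntax; _×_; _,_; proj₁; proj₂)
open import Data.List using (List; []; _∷_)
open import Data.List.Membership.Propositional using (_∈_)
open import Data.List.Relation.Unary.Any using (here; there)
open import Relation.Binary.PropositionalEquality using (refl)
open import Relation.Binary using (Rel; IsEquivalence)

-- Finite partial maps ℕ ⇀ X (operation symbols are natural numbers).
-- Canonical representation: a list of (gap , value) pairs.  The key of
-- the first entry is its gap g; the keys of the remaining entries are
-- shifted by suc g.  Thus keys are strictly increasing and every finite
-- partial map has exactly one representation (no duplicate keys, no
-- ordering ambiguity).

FMap : Set → Set
FMap X = List (ℕ × X)

data _∋_↦_ {X : Set} : FMap X → ℕ → X → Set where
  here  : ∀ {g x m} → ((g , x) ∷ m) ∋ g ↦ x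
  there : ∀ {g y m k x} → m ∋ k ↦ x → ((g , y) ∷ m) ∋ suc (g + k) ↦ x

record Category : Set₁ where
  infix  4 _≈_
  infix  3 _⇒_
  infixr 9 _∘_
  field
    Obj : Set
    _⇒_ : Obj → Obj → Set
    _≈_ : ∀ {A B} → Rel (A ⇒ B) 0ℓ
    id  : ∀ {A} → A ⇒ A
    _∘_ : ∀ {A B C} → B ⇒ C → A ⇒ B → A ⇒ C
    ≈-equiv   : ∀ {A B} → IsEquivalence (_≈_ {A} {B})
    ∘-resp-≈  : ∀ {A B C} {f h : B ⇒ C} {g i : A ⇒ B} →
                f ≈ h → g ≈ i → f ∘ g ≈ h ∘ i
    identityˡ : ∀ {A B} {f : A ⇒ B} → id ∘ f ≈ f
    identityʳ : ∀ {A B} {f : A ⇒ B} → f ∘ id ≈ f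
    assoc     : ∀ {A B C D} {f : A ⇒ B} {g : B ⇒ C} {h : C ⇒ D} →
                (h ∘ g) ∘ f ≈ h ∘ (g ∘ f)

record Cartesian (𝒞 : Category) : Set where
  open Category 𝒞
  infixr 7 _⊗_
  field
    𝟙        : Obj
    !        : ∀ {A} → A ⇒ 𝟙
    !-unique : ∀ {A} (f : A ⇒ 𝟙) → f ≈ !
    _⊗_      : Obj → Obj → Obj
    π₁       : ∀ {A B} → A ⊗ B ⇒ A
    π₂       : ∀ {A B} → A ⊗ B ⇒ B
    ⟨_,_⟩    : ∀ {X A B} → X ⇒ A → X ⇒ B → X ⇒ A ⊗ B
    project₁ : ∀ {X A B} {f : X ⇒ A} {g : X ⇒ B} → π₁ ∘ ⟨ f , g ⟩ ≈ f
    project₂ : ∀ {X A B} {f : X ⇒ A} {g : X ⇒ B} → π₂ ∘ ⟨ f , g ⟩ ≈ g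
    ⟨⟩-unique : ∀ {X A B} {f : X ⇒ A} {g : X ⇒ B} {h : X ⇒ A ⊗ B} →
                π₁ ∘ h ≈ f → π₂ ∘ h ≈ g → ⟨ f , g ⟩ ≈ h

  infixr 8 _⁂_
  _⁂_ : ∀ {A B C D} → A ⇒ B → C ⇒ D → A ⊗ C ⇒ B ⊗ D
  f ⁂ g = ⟨ f ∘ π₁ , g ∘ π₂ ⟩

  swap : ∀ {A B} → A ⊗ B ⇒ B ⊗ A
  swap = ⟨ π₂ , π₁ ⟩

  α : ∀ {A B C} → (A ⊗ B) ⊗ C ⇒ A ⊗ (B ⊗ C)
  α = ⟨ π₁ ∘ π₁ , ⟨ π₂ ∘ π₁ , π₂ ⟩ ⟩

record StrongMonad (𝒞 : Category) (cart : Cartesian 𝒞) : Set where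
  open Category 𝒞
  open Cartesian cart
  field
    T      : Obj → Obj
    T₁     : ∀ {A B} → A ⇒ B → T A ⇒ T B
    T₁-resp : ∀ {A B} {f g : A ⇒ B} → f ≈ g → T₁ f ≈ T₁ g
    T₁-id  : ∀ {A} → T₁ (id {A}) ≈ id
    T₁-∘   : ∀ {A B C} {f : A ⇒ B} {g : B ⇒ C} → T₁ (g ∘ f) ≈ T₁ g ∘ T₁ f
    η      : ∀ {A} → A ⇒ T A
    μ      : ∀ {A} → T (T A) ⇒ T A
    η-nat  : ∀ {A B} {f : A ⇒ B} → T₁ f ∘ η ≈ η ∘ f
    μ-nat  : ∀ {A B} {f : A ⇒ B} → T₁ f ∘ μ ≈ μ ∘ T₁ (T₁ f)
    μ-η    : ∀ {A} → μ ∘ η {T A} ≈ id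
    μ-Tη   : ∀ {A} → μ ∘ T₁ (η {A}) ≈ id
    μ-assoc : ∀ {A} → μ ∘ T₁ (μ {A}) ≈ μ ∘ μ
    st     : ∀ {A B} → A ⊗ T B ⇒ T (A ⊗ B)
    st-nat : ∀ {A B C D} {f : A ⇒ C} {g : B ⇒ D} →
             T₁ (f ⁂ g) ∘ st ≈ st ∘ (f ⁂ T₁ g)
    st-unit : ∀ {A} → T₁ π₂ ∘ st {𝟙} {A} ≈ π₂
    st-assoc : ∀ {A B C} →
             T₁ (α {A} {B} {C}) ∘ st ≈ st ∘ (id ⁂ st) ∘ α
    st-η   : ∀ {A B} → st ∘ (id ⁂ η) ≈ η {A ⊗ B}
    st-μ   : ∀ {A B} → st ∘ (id ⁂ μ) ≈ μ ∘ T₁ st ∘ st {A} {T B}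

record KleisliExp {𝒞 : Category} {cart : Cartesian 𝒞}
                  (M : StrongMonad 𝒞 cart) : Set where
  open Category 𝒞
  open Cartesian cart
  open StrongMonad M
  infixr 6 _⇛_
  field
    _⇛_      : Obj → Obj → Obj
    ev       : ∀ {Y Z} → (Y ⇛ Z) ⊗ Y ⇒ T Z
    Λ        : ∀ {X Y Z} → X ⊗ Y ⇒ T Z → X ⇒ (Y ⇛ Z)
    Λ-β      : ∀ {X Y Z} {f : X ⊗ Y ⇒ T Z} → ev ∘ (Λ f ⁂ id) ≈ f
    Λ-unique : ∀ {X Y Z} {f : X ⊗ Y ⇒ T Z} {g : X ⇒ (Y ⇛ Z)} →
               ev ∘ (g ⁂ id) ≈ f → g ≈ Λ f

SemSig : Category → Set
SemSig 𝒞 = FMap (Category.Obj 𝒞 × Category.Obj 𝒞)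

record PreModel : Set₁ where
  field
    𝒞     : Category
    cart  : Cartesian 𝒞
    monad : SemSig 𝒞 → StrongMonad 𝒞 cart
    kexp  : (S : SemSig 𝒞) → KleisliExp (monad S)

module PreModelOps (P : PreModel) where
  open PreModel P public
  open Category 𝒞 public
  open Cartesian cart public

  T : SemSig 𝒞 → Obj → Obj
  T S = StrongMonad.T (monad S)
  T₁ : ∀ S {A B} → A ⇒ B → T S A ⇒ T S B
  T₁ S = StrongMonad.T₁ (monad S)
  η : ∀ S {A} → A ⇒ T S A
  η S = StrongMonad.η (monad S)
  μ : ∀ S {A} → T S (T S A) ⇒ T S A
  μ S = StrongMonad.μ (monad S)
  st : ∀ S {A B} → A ⊗ T S B ⇒ T S (A ⊗ B)
  st S = StrongMonad.st (monad S)
  _⇛[_]_ : Obj → SemSig 𝒞 → Obj → Obj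
  Y ⇛[ S ] Z = KleisliExp._⇛_ (kexp S) Y Z
  ev : ∀ S {Y Z} → (Y ⇛[ S ] Z) ⊗ Y ⇒ T S Z
  ev S = KleisliExp.ev (kexp S)
  Λ : ∀ S {X Y Z} → X ⊗ Y ⇒ T S Z → X ⇒ (Y ⇛[ S ] Z)
  Λ S = KleisliExp.Λ (kexp S)

  Hobj : SemSig 𝒞 → SemSig 𝒞 → Obj → Obj
  Hobj [] S' X = 𝟙
  Hobj ((g , (A , B)) ∷ S) S' X =
    ((A ⊗ (B ⇛[ S' ] X)) ⇛[ S' ] X) ⊗ Hobj S S' X

  hproj : ∀ {S S' X o A B} → S ∋ o ↦ (A , B) →
          Hobj S S' X ⇒ ((A ⊗ (B ⇛[ S' ] X)) ⇛[ S' ] X)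
  hproj here      = π₁
  hproj (there m) = hproj m ∘ π₂

record Model (P : PreModel) : Set where
  open PreModelOps P
  field
    ⟦op⟧   : ∀ S {o A B} → S ∋ o ↦ (A , B) → A ⇒ T S B
    handle : ∀ S S' X → Hobj S S' X ⊗ T S (T S' X) ⇒ T S' X
    handle-η : ∀ S S' X → handle S S' X ∘ (id ⁂ η S) ≈ π₂
    handle-μ : ∀ S S' X →
      handle S S' X ∘ (id ⁂ μ S)
        ≈ handle S S' X ∘ (id ⁂ T₁ S (handle S S' X)) ∘ ⟨ π₁ , st S ⟩
    handle-op : ∀ S S' X {o A B} (m : S ∋ o ↦ (A , B)) →
      handle S S' X ∘ (id ⁂ (T₁ S (ev S') ∘ st S ∘ swap ∘ (⟦op⟧ S m ⁂ id)))
        ≈ ev S' ∘ (hproj m ⁂ id)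

infixr 5 _⟶_
infix  6 _!_

data VTy : Set
data CTy : Set

Sig : Set
Sig = FMap (VTy × VTy)

data VTy where
  _⟶_ : VTy → CTy → VTy
  ∏   : List VTy → VTy

data CTy where
  _!_ : VTy → Sig → CTy

Ctx : Set
Ctx = List VTy

data Val  (Γ : Ctx) : VTy → Set
data Vals (Γ : Ctx) : List VTy → Set
data Comp (Γ : Ctx) : CTy → Set
data Hdl  (Γ : Ctx) : Sig → CTy → Set

data Val Γ where
  var  : ∀ {A} → A ∈ Γ → Val Γ A
  ƛ    : ∀ {A C} → Comp (A ∷ Γ) C → Val Γ (A ⟶ C)
  ⟪_⟫  : ∀ {As} → Vals Γ As → Val Γ (∏ As)
  proj : ∀ {As A} → A ∈ As → Val Γ (∏ As) → Val Γ A

data Vals Γ where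
  []  : Vals Γ []
  _∷_ : ∀ {A As} → Val Γ A → Vals Γ As → Vals Γ (A ∷ As)

data Comp Γ where
  _·_     : ∀ {A C} → Val Γ (A ⟶ C) → Val Γ A → Comp Γ C
  return  : ∀ {A Σ} → Val Γ A → Comp Γ (A ! Σ)
  letin   : ∀ {A B Σ} → Comp Γ (A ! Σ) → Comp (A ∷ Γ) (B ! Σ) → Comp Γ (B ! Σ)
  opcall  : ∀ {Σ o A B} → Σ ∋ o ↦ (A , B) → Val Γ A → Comp Γ (B ! Σ)
  handle_by_to_ : ∀ {A Σ C} → Comp Γ (A ! Σ) → Hdl Γ Σ C → Comp (A ∷ Γ) C → Comp Γ C

data Hdl Γ where
  []     : ∀ {C} → Hdl Γ [] C
  -- clause op(x , k) ↦ M with  Γ , x : A , k : B ⟶ C ⊢ M : C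
  clause : ∀ {g A B Σ C} → Comp ((B ⟶ C) ∷ A ∷ Γ) C → Hdl Γ Σ C →
           Hdl Γ ((g , (A , B)) ∷ Σ) C

Ren : Ctx → Ctx → Set
Ren Γ Δ = ∀ {A} → A ∈ Γ → A ∈ Δ

ext : ∀ {Γ Δ B} → Ren Γ Δ → Ren (B ∷ Γ) (B ∷ Δ)
ext ρ (here p)  = here p
ext ρ (there i) = there (ρ i)

renV  : ∀ {Γ Δ A}   → Ren Γ Δ → Val Γ A → Val Δ A
renVs : ∀ {Γ Δ As}  → Ren Γ Δ → Vals Γ As → Vals Δ As
renC  : ∀ {Γ Δ C}   → Ren Γ Δ → Comp Γ C → Comp Δ C
renH  : ∀ {Γ Δ Σ C} → Ren Γ Δ → Hdl Γ Σ C → Hdl Δ Σ C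

renV ρ (var i)    = var (ρ i)
renV ρ (ƛ M)      = ƛ (renC (ext ρ) M)
renV ρ ⟪ Vs ⟫     = ⟪ renVs ρ Vs ⟫
renV ρ (proj i V) = proj i (renV ρ V)
renVs ρ []       = []
renVs ρ (V ∷ Vs) = renV ρ V ∷ renVs ρ Vs
renC ρ (V · W)      = renV ρ V · renV ρ W
renC ρ (return V)   = return (renV ρ V)
renC ρ (letin M N)  = letin (renC ρ M) (renC (ext ρ) N)
renC ρ (opcall m V) = opcall m (renV ρ V)
renC ρ (handle M by H to N) = handle renC ρ M by renH ρ H to renC (ext ρ) N
renH ρ []             = []
renH ρ (clause M H)   = clause (renC (ext (ext ρ)) M) (renH ρ H)

Sub : Ctx → Ctx → Set
Sub Γ Δ = ∀ {A} → A ∈ Γ → Val Δ A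

exts : ∀ {Γ Δ B} → Sub Γ Δ → Sub (B ∷ Γ) (B ∷ Δ)
exts σ (here p)  = var (here p)
exts σ (there i) = renV there (σ i)

subV  : ∀ {Γ Δ A}   → Sub Γ Δ → Val Γ A → Val Δ A
subVs : ∀ {Γ Δ As}  → Sub Γ Δ → Vals Γ As → Vals Δ As
subC  : ∀ {Γ Δ C}   → Sub Γ Δ → Comp Γ C → Comp Δ C
subH  : ∀ {Γ Δ Σ C} → Sub Γ Δ → Hdl Γ Σ C → Hdl Δ Σ C

subV σ (var i)    = σ i
subV σ (ƛ M)      = ƛ (subC (exts σ) M)
subV σ ⟪ Vs ⟫     = ⟪ subVs σ Vs ⟫
subV σ (proj i V) = proj i (subV σ V)
subVs σ []       = []
subVs σ (V ∷ Vs) = subV σ V ∷ subVs σ Vs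
subC σ (V · W)      = subV σ V · subV σ W
subC σ (return V)   = return (subV σ V)
subC σ (letin M N)  = letin (subC σ M) (subC (exts σ) N)
subC σ (opcall m V) = opcall m (subV σ V)
subC σ (handle M by H to N) = handle subC σ M by subH σ H to subC (exts σ) N
subH σ []             = []
subH σ (clause M H)   = clause (subC (exts (exts σ)) M) (subH σ H)

sub1 : ∀ {Γ A} → Val Γ A → Sub (A ∷ Γ) Γ
sub1 V (here refl) = V
sub1 V (there i)   = var i

_[_] : ∀ {Γ A C} → Comp (A ∷ Γ) C → Val Γ A → Comp Γ C
M [ V ] = subC (sub1 V) M

sub2 : ∀ {Γ A B} → Val Γ A → Val Γ B → Sub (B ∷ A ∷ Γ) Γ
sub2 V K (here refl)         = K
sub2 V K (there (here refl)) = V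
sub2 V K (there (there i))   = var i

x₀ : ∀ {Γ A} → Val (A ∷ Γ) A
x₀ = var (here refl)

lookupVs : ∀ {Γ As A} → Vals Γ As → A ∈ As → Val Γ A
lookupVs (V ∷ Vs) (here refl) = V
lookupVs (V ∷ Vs) (there i)   = lookupVs Vs i

tabulateVs : ∀ {Γ} As → (∀ {A} → A ∈ As → Val Γ A) → Vals Γ As
tabulateVs []       f = []
tabulateVs (A ∷ As) f = f (here refl) ∷ tabulateVs As (λ i → f (there i))

clauseOf : ∀ {Γ Σ C o A B} → Hdl Γ Σ C → Σ ∋ o ↦ (A , B) → Comp ((B ⟶ C) ∷ A ∷ Γ) C
clauseOf (clause M H) here      = M
clauseOf (clause M H) (there m) = clauseOf H m

infix 4 _≈v_ _≈vs_ _≈c_ _≈h_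

data _≈v_  : ∀ {Γ A}   → Val Γ A   → Val Γ A   → Set
data _≈vs_ : ∀ {Γ As}  → Vals Γ As → Vals Γ As → Set
data _≈c_  : ∀ {Γ C}   → Comp Γ C  → Comp Γ C  → Set
data _≈h_  : ∀ {Γ Σ C} → Hdl Γ Σ C → Hdl Γ Σ C → Set

data _≈v_ where
  refl  : ∀ {Γ A} {V : Val Γ A} → V ≈v V
  sym   : ∀ {Γ A} {V W : Val Γ A} → V ≈v W → W ≈v V
  trans : ∀ {Γ A} {U V W : Val Γ A} → U ≈v V → V ≈v W → U ≈v W
  ƛ-cong    : ∀ {Γ A C} {M N : Comp (A ∷ Γ) C} → M ≈c N → ƛ M ≈v ƛ N
  ⟪⟫-cong   : ∀ {Γ As} {Vs Ws : Vals Γ As} → Vs ≈vs Ws → ⟪ Vs ⟫ ≈v ⟪ Ws ⟫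
  proj-cong : ∀ {Γ As A} (i : A ∈ As) {V W : Val Γ (∏ As)} →
              V ≈v W → proj i V ≈v proj i W
  ∏-β : ∀ {Γ As A} (i : A ∈ As) (Vs : Vals Γ As) → proj i ⟪ Vs ⟫ ≈v lookupVs Vs i
  ∏-η : ∀ {Γ As} (V : Val Γ (∏ As)) → V ≈v ⟪ tabulateVs As (λ i → proj i V) ⟫
  ⟶-η : ∀ {Γ A C} (V : Val Γ (A ⟶ C)) → V ≈v ƛ (renV there V · x₀)

data _≈vs_ where
  []  : ∀ {Γ} → [] ≈vs ([] {Γ})
  _∷_ : ∀ {Γ A As} {V W : Val Γ A} {Vs Ws : Vals Γ As} →
        V ≈v W → Vs ≈vs Ws → (V ∷ Vs) ≈vs (W ∷ Ws)

data _≈c_ where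
  refl  : ∀ {Γ C} {M : Comp Γ C} → M ≈c M
  sym   : ∀ {Γ C} {M N : Comp Γ C} → M ≈c N → N ≈c M
  trans : ∀ {Γ C} {L M N : Comp Γ C} → L ≈c M → M ≈c N → L ≈c N
  ·-cong : ∀ {Γ A C} {V V' : Val Γ (A ⟶ C)} {W W' : Val Γ A} →
           V ≈v V' → W ≈v W' → V · W ≈c V' · W'
  return-cong : ∀ {Γ A Σ} {V W : Val Γ A} → V ≈v W → return {Σ = Σ} V ≈c return W
  letin-cong : ∀ {Γ A B Σ} {M M' : Comp Γ (A ! Σ)} {N N' : Comp (A ∷ Γ) (B ! Σ)} →
               M ≈c M' → N ≈c N' → letin M N ≈c letin M' N'
  opcall-cong : ∀ {Γ Σ o A B} (m : Σ ∋ o ↦ (A , B)) {V W : Val Γ A} →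
                V ≈v W → opcall m V ≈c opcall m W
  handle-cong : ∀ {Γ A Σ C} {M M' : Comp Γ (A ! Σ)} {H H' : Hdl Γ Σ C}
                {N N' : Comp (A ∷ Γ) C} → M ≈c M' → H ≈h H' → N ≈c N' →
                (handle M by H to N) ≈c (handle M' by H' to N')
  ⟶-β : ∀ {Γ A C} (M : Comp (A ∷ Γ) C) (V : Val Γ A) → ƛ M · V ≈c M [ V ]
  let-β : ∀ {Γ A B Σ} (V : Val Γ A) (M : Comp (A ∷ Γ) (B ! Σ)) →
          letin (return V) M ≈c M [ V ]
  let-η : ∀ {Γ A Σ} (M : Comp Γ (A ! Σ)) → letin M (return x₀) ≈c M
  let-assoc : ∀ {Γ A B D Σ} (L : Comp Γ (A ! Σ)) (M : Comp (A ∷ Γ) (B ! Σ))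
              (N : Comp (B ∷ Γ) (D ! Σ)) →
              letin (letin L M) N ≈c letin L (letin M (renC (ext there) N))
  handle-return : ∀ {Γ A Σ C} (V : Val Γ A) (H : Hdl Γ Σ C) (M : Comp (A ∷ Γ) C) →
                  (handle return V by H to M) ≈c M [ V ]
  handle-let : ∀ {Γ A B Σ C} (L : Comp Γ (A ! Σ)) (M : Comp (A ∷ Γ) (B ! Σ))
               (H : Hdl Γ Σ C) (N : Comp (B ∷ Γ) C) →
               (handle letin L M by H to N)
                 ≈c (handle L by H to (handle M by renH there H to renC (ext there) N))
  handle-op : ∀ {Γ Σ C o A B} (m : Σ ∋ o ↦ (A , B)) (V : Val Γ A) (H : Hdl Γ Σ C)
              (M : Comp (B ∷ Γ) C) →
              (handle opcall m V by H to M) ≈c subC (sub2 V (ƛ M)) (clauseOf H m)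

data _≈h_ where
  refl  : ∀ {Γ Σ C} {H : Hdl Γ Σ C} → H ≈h H
  sym   : ∀ {Γ Σ C} {H K : Hdl Γ Σ C} → H ≈h K → K ≈h H
  trans : ∀ {Γ Σ C} {H K L : Hdl Γ Σ C} → H ≈h K → K ≈h L → H ≈h L
  clause-cong : ∀ {Γ g A B Σ C} {M M' : Comp ((B ⟶ C) ∷ A ∷ Γ) C} {H H' : Hdl Γ Σ C} →
                M ≈c M' → H ≈h H' → clause {g = g} M H ≈h clause M' H'

module Interp {P : PreModel} (𝓜 : Model P) where
  open PreModelOps P
  open Model 𝓜

  ⟦_⟧v  : VTy → Obj
  ⟦_⟧vs : List VTy → Obj
  ⟦_⟧s  : Sig → SemSig 𝒞

  ⟦ A ⟶ (B ! Σ) ⟧v = ⟦ A ⟧v ⇛[ ⟦ Σ ⟧s ] ⟦ B ⟧v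
  ⟦ ∏ As ⟧v        = ⟦ As ⟧vs
  ⟦ [] ⟧vs     = 𝟙
  ⟦ A ∷ As ⟧vs = ⟦ A ⟧v ⊗ ⟦ As ⟧vs
  ⟦ [] ⟧s                 = []
  ⟦ (g , (A , B)) ∷ Σ ⟧s = (g , (⟦ A ⟧v , ⟦ B ⟧v)) ∷ ⟦ Σ ⟧s

  ⟦_⟧c : CTy → Obj
  ⟦ A ! Σ ⟧c = T ⟦ Σ ⟧s ⟦ A ⟧v

  ⟦_⇒_⟧h : Sig → CTy → Obj
  ⟦ Σ ⇒ A ! Σ' ⟧h = Hobj ⟦ Σ ⟧s ⟦ Σ' ⟧s ⟦ A ⟧v

  ⟦_⟧ctx : Ctx → Obj
  ⟦ [] ⟧ctx    = 𝟙
  ⟦ A ∷ Γ ⟧ctx = ⟦ Γ ⟧ctx ⊗ ⟦ A ⟧v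

  ⟦_⟧var : ∀ {Γ A} → A ∈ Γ → ⟦ Γ ⟧ctx ⇒ ⟦ A ⟧v
  ⟦ here refl ⟧var = π₂
  ⟦ there i ⟧var   = ⟦ i ⟧var ∘ π₁

  ⟦_⟧proj : ∀ {As A} → A ∈ As → ⟦ As ⟧vs ⇒ ⟦ A ⟧v
  ⟦ here refl ⟧proj = π₁
  ⟦ there i ⟧proj   = ⟦ i ⟧proj ∘ π₂

  ⟦_⟧op : ∀ {Σ o A B} → Σ ∋ o ↦ (A , B) → ⟦ Σ ⟧s ∋ o ↦ (⟦ A ⟧v , ⟦ B ⟧v)
  ⟦ here ⟧op    = here
  ⟦ there m ⟧op = there ⟦ m ⟧op

  ⟦_⟧V  : ∀ {Γ A}   → Val Γ A   → ⟦ Γ ⟧ctx ⇒ ⟦ A ⟧v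
  ⟦_⟧Vs : ∀ {Γ As}  → Vals Γ As → ⟦ Γ ⟧ctx ⇒ ⟦ As ⟧vs
  ⟦_⟧M  : ∀ {Γ C}   → Comp Γ C  → ⟦ Γ ⟧ctx ⇒ ⟦ C ⟧c
  ⟦_⟧H  : ∀ {Γ Σ C} → Hdl Γ Σ C → ⟦ Γ ⟧ctx ⇒ ⟦ Σ ⇒ C ⟧h

  ⟦ var i ⟧V              = ⟦ i ⟧var
  ⟦ ƛ {C = B ! Σ} M ⟧V    = Λ ⟦ Σ ⟧s ⟦ M ⟧M
  ⟦ ⟪ Vs ⟫ ⟧V             = ⟦ Vs ⟧Vs
  ⟦ proj i V ⟧V           = ⟦ i ⟧proj ∘ ⟦ V ⟧V
  ⟦ [] ⟧Vs     = !
  ⟦ V ∷ Vs ⟧Vs = ⟨ ⟦ V ⟧V , ⟦ Vs ⟧Vs ⟩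
  ⟦ _·_ {C = B ! Σ} V W ⟧M = ev ⟦ Σ ⟧s ∘ ⟨ ⟦ V ⟧V , ⟦ W ⟧V ⟩
  ⟦ return {Σ = Σ} V ⟧M    = η ⟦ Σ ⟧s ∘ ⟦ V ⟧V
  ⟦ letin {Σ = Σ} M N ⟧M   =
    μ ⟦ Σ ⟧s ∘ T₁ ⟦ Σ ⟧s ⟦ N ⟧M ∘ st ⟦ Σ ⟧s ∘ ⟨ id , ⟦ M ⟧M ⟩
  ⟦ opcall {Σ = Σ} m V ⟧M  = ⟦op⟧ ⟦ Σ ⟧s ⟦ m ⟧op ∘ ⟦ V ⟧V
  ⟦ handle_by_to_ {Σ = Σ} {C = X ! Σ'} M H N ⟧M =
    handle ⟦ Σ ⟧s ⟦ Σ' ⟧s ⟦ X ⟧v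
      ∘ ⟨ ⟦ H ⟧H , T₁ ⟦ Σ ⟧s ⟦ N ⟧M ∘ st ⟦ Σ ⟧s ∘ ⟨ id , ⟦ M ⟧M ⟩ ⟩
  ⟦ [] {C = X ! Σ'} ⟧H = !
  -- tuple of curried clauses:  Λ (⟦M_op⟧ ∘ (Γ ⊗ (A ⊗ K) ≅ (Γ ⊗ A) ⊗ K))
  ⟦ clause {C = X ! Σ'} M H ⟧H =
    ⟨ Λ ⟦ Σ' ⟧s (⟦ M ⟧M ∘ ⟨ ⟨ π₁ , π₁ ∘ π₂ ⟩ , π₂ ∘ π₂ ⟩) , ⟦ H ⟧H ⟩

ValidV : ∀ {Γ A} → Val Γ A → Val Γ A → Set₁
ValidV V W = ∀ (P : PreModel) (𝓜 : Model P) →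
  Category._≈_ (PreModel.𝒞 P) (Interp.⟦_⟧V 𝓜 V) (Interp.⟦_⟧V 𝓜 W)

ValidC : ∀ {Γ C} → Comp Γ C → Comp Γ C → Set₁
ValidC M N = ∀ (P : PreModel) (𝓜 : Model P) →
  Category._≈_ (PreModel.𝒞 P) (Interp.⟦_⟧M 𝓜 M) (Interp.⟦_⟧M 𝓜 N)

ValidH : ∀ {Γ Σ C} → Hdl Γ Σ C → Hdl Γ Σ C → Set₁
ValidH H K = ∀ (P : PreModel) (𝓜 : Model P) →
  Category._≈_ (PreModel.𝒞 P) (Interp.⟦_⟧H 𝓜 H) (Interp.⟦_⟧H 𝓜 K)

{-# OPTIONS --safe #-}
-- Completeness via a term model.  Its objects are value types; a morphism X → Y is a family of maps
-- Val Γ X → Val Γ Y that respects provable equality and commutes with substitution, and two morphisms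
-- are equal when they agree up to provable equality.  T_S Y is the thunk type ∏ [] ⟶ Y ! S, the
-- Kleisli exponential is the function type, ⟦op⟧ is the operation call and handle handles a forced
-- thunk; every model axiom is then an instance of the equational theory.  In this model the
-- interpretation of a term at an environment γ is provably equal to the term under the substitution
-- that γ represents, so at the identity environment equal denotations give provably equal terms.
module Submission where

open import Defs
open import Level using (0ℓ)
open import Function using (_∘_)
open import Data.Product using (_×_; _,_)
open import Data.List using (List; []; _∷_)
open import Data.List.Membership.Propositional using (_∈_)
open import Data.List.Relation.Unary.Any using (here; there)
open import Relation.Binary.Bundles using (Setoid)
import Relation.Binary.Reasoning.Setoid as SetoidReasoning
open import Relation.Binary.PropositionalEquality as ≡ using (_≡_; refl; cong; cong₂)

variable
  Γ Δ Δ′ Ξ : Ctx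
  A B D X Y : VTy
  As : List VTy
  C : CTy
  Σ Σ′ S S′ : Sig

cong₃ : ∀ {a b c d} {P : Set a} {Q : Set b} {R : Set c} {S : Set d}
        (f : P → Q → R → S) {x y u v w z} → x ≡ y → u ≡ v → w ≡ z → f x u w ≡ f y v z
cong₃ f refl refl refl = refl

infix 4 _≗_
_≗_ : Sub Γ Δ → Sub Γ Δ → Set
σ ≗ τ = ∀ {A} i → σ {A} i ≡ τ i

ren⇒sub : Ren Γ Δ → Sub Γ Δ
ren⇒sub ρ i = var (ρ i)

_ₛ∘ᵣ_ : Sub Δ Ξ → Ren Γ Δ → Sub Γ Ξ
(σ ₛ∘ᵣ ρ) i = σ (ρ i)

_ᵣ∘ₛ_ : Ren Δ Ξ → Sub Γ Δ → Sub Γ Ξ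
(ρ ᵣ∘ₛ σ) i = renV ρ (σ i)

variable
  ρ : Ren Γ Δ
  σ τ : Sub Γ Δ

ren⇒sub-ext : ren⇒sub ρ ≗ σ → ren⇒sub (ext {B = B} ρ) ≗ exts σ
ren⇒sub-ext h (here p)  = refl
ren⇒sub-ext h (there i) = cong (renV there) (h i)

ren-as-subV  : ren⇒sub ρ ≗ σ → (V : Val Γ A) → renV ρ V ≡ subV σ V
ren-as-subVs : ren⇒sub ρ ≗ σ → (Vs : Vals Γ As) → renVs ρ Vs ≡ subVs σ Vs
ren-as-subC  : ren⇒sub ρ ≗ σ → (M : Comp Γ C) → renC ρ M ≡ subC σ M
ren-as-subH  : ren⇒sub ρ ≗ σ → (H : Hdl Γ Σ C) → renH ρ H ≡ subH σ H
ren-as-subV h (var i)    = h i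
ren-as-subV h (ƛ M)      = cong ƛ (ren-as-subC (ren⇒sub-ext h) M)
ren-as-subV h ⟪ Vs ⟫     = cong ⟪_⟫ (ren-as-subVs h Vs)
ren-as-subV h (proj i V) = cong (proj i) (ren-as-subV h V)
ren-as-subVs h []       = refl
ren-as-subVs h (V ∷ Vs) = cong₂ _∷_ (ren-as-subV h V) (ren-as-subVs h Vs)
ren-as-subC h (V · W)      = cong₂ _·_ (ren-as-subV h V) (ren-as-subV h W)
ren-as-subC h (return V)   = cong return (ren-as-subV h V)
ren-as-subC h (letin M N)  = cong₂ letin (ren-as-subC h M) (ren-as-subC (ren⇒sub-ext h) N)
ren-as-subC h (opcall m V) = cong (opcall m) (ren-as-subV h V)
ren-as-subC h (handle M by H to N) =
  cong₃ handle_by_to_ (ren-as-subC h M) (ren-as-subH h H) (ren-as-subC (ren⇒sub-ext h) N)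
ren-as-subH h []           = refl
ren-as-subH h (clause M H) =
  cong₂ clause (ren-as-subC (ren⇒sub-ext (ren⇒sub-ext h)) M) (ren-as-subH h H)

sub-ren-ext : σ ₛ∘ᵣ ρ ≗ τ → exts {B = B} σ ₛ∘ᵣ ext ρ ≗ exts τ
sub-ren-ext h (here p)  = refl
sub-ren-ext h (there i) = cong (renV there) (h i)

sub-renV  : σ ₛ∘ᵣ ρ ≗ τ → (V : Val Γ A) → subV σ (renV ρ V) ≡ subV τ V
sub-renVs : σ ₛ∘ᵣ ρ ≗ τ → (Vs : Vals Γ As) → subVs σ (renVs ρ Vs) ≡ subVs τ Vs
sub-renC  : σ ₛ∘ᵣ ρ ≗ τ → (M : Comp Γ C) → subC σ (renC ρ M) ≡ subC τ M
sub-renH  : σ ₛ∘ᵣ ρ ≗ τ → (H : Hdl Γ Σ C) → subH σ (renH ρ H) ≡ subH τ H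
sub-renV h (var i)    = h i
sub-renV h (ƛ M)      = cong ƛ (sub-renC (sub-ren-ext h) M)
sub-renV h ⟪ Vs ⟫     = cong ⟪_⟫ (sub-renVs h Vs)
sub-renV h (proj i V) = cong (proj i) (sub-renV h V)
sub-renVs h []       = refl
sub-renVs h (V ∷ Vs) = cong₂ _∷_ (sub-renV h V) (sub-renVs h Vs)
sub-renC h (V · W)      = cong₂ _·_ (sub-renV h V) (sub-renV h W)
sub-renC h (return V)   = cong return (sub-renV h V)
sub-renC h (letin M N)  = cong₂ letin (sub-renC h M) (sub-renC (sub-ren-ext h) N)
sub-renC h (opcall m V) = cong (opcall m) (sub-renV h V)
sub-renC h (handle M by H to N) =
  cong₃ handle_by_to_ (sub-renC h M) (sub-renH h H) (sub-renC (sub-ren-ext h) N)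
sub-renH h []           = refl
sub-renH h (clause M H) = cong₂ clause (sub-renC (sub-ren-ext (sub-ren-ext h)) M) (sub-renH h H)

sub-id-ext : σ ≗ var → exts {B = B} σ ≗ var
sub-id-ext h (here p)  = refl
sub-id-ext h (there i) = cong (renV there) (h i)

sub-idV  : σ ≗ var → (V : Val Γ A) → subV σ V ≡ V
sub-idVs : σ ≗ var → (Vs : Vals Γ As) → subVs σ Vs ≡ Vs
sub-idC  : σ ≗ var → (M : Comp Γ C) → subC σ M ≡ M
sub-idH  : σ ≗ var → (H : Hdl Γ Σ C) → subH σ H ≡ H
sub-idV h (var i)    = h i
sub-idV h (ƛ M)      = cong ƛ (sub-idC (sub-id-ext h) M)
sub-idV h ⟪ Vs ⟫     = cong ⟪_⟫ (sub-idVs h Vs)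
sub-idV h (proj i V) = cong (proj i) (sub-idV h V)
sub-idVs h []       = refl
sub-idVs h (V ∷ Vs) = cong₂ _∷_ (sub-idV h V) (sub-idVs h Vs)
sub-idC h (V · W)      = cong₂ _·_ (sub-idV h V) (sub-idV h W)
sub-idC h (return V)   = cong return (sub-idV h V)
sub-idC h (letin M N)  = cong₂ letin (sub-idC h M) (sub-idC (sub-id-ext h) N)
sub-idC h (opcall m V) = cong (opcall m) (sub-idV h V)
sub-idC h (handle M by H to N) =
  cong₃ handle_by_to_ (sub-idC h M) (sub-idH h H) (sub-idC (sub-id-ext h) N)
sub-idH h []           = refl
sub-idH h (clause M H) = cong₂ clause (sub-idC (sub-id-ext (sub-id-ext h)) M) (sub-idH h H)

ren-idC : (∀ {A} (i : A ∈ Γ) → ρ i ≡ i) → (M : Comp Γ C) → renC ρ M ≡ M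
ren-idC h M = ≡.trans (ren-as-subC (λ _ → refl) M) (sub-idC (λ i → cong var (h i)) M)

module _ {ρ₁ : Ren Δ Ξ} {ρ₂ : Ren Γ Δ} {ρ₃ : Ren Γ Ξ} (h : ∀ {A} (i : A ∈ Γ) → ρ₁ (ρ₂ i) ≡ ρ₃ i) where

  ren-renV : (V : Val Γ A) → renV ρ₁ (renV ρ₂ V) ≡ renV ρ₃ V
  ren-renV V = ≡.trans (ren-as-subV (λ _ → refl) _)
                       (≡.trans (sub-renV (λ i → cong var (h i)) V) (≡.sym (ren-as-subV (λ _ → refl) V)))

  ren-renC : (M : Comp Γ C) → renC ρ₁ (renC ρ₂ M) ≡ renC ρ₃ M
  ren-renC M = ≡.trans (ren-as-subC (λ _ → refl) _)
                       (≡.trans (sub-renC (λ i → cong var (h i)) M) (≡.sym (ren-as-subC (λ _ → refl) M)))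

  ren-renH : (H : Hdl Γ Σ C) → renH ρ₁ (renH ρ₂ H) ≡ renH ρ₃ H
  ren-renH H = ≡.trans (ren-as-subH (λ _ → refl) _)
                       (≡.trans (sub-renH (λ i → cong var (h i)) H) (≡.sym (ren-as-subH (λ _ → refl) H)))

wk : Val Γ B → Val (A ∷ Γ) B
wk = renV there

ren-ext-wkV : (V : Val Γ B) → renV (ext {B = A} ρ) (wk V) ≡ wk (renV ρ V)
ren-ext-wkV V = ≡.trans (ren-renV (λ _ → refl) V) (≡.sym (ren-renV (λ _ → refl) V))

ren-ext-wkH : (H : Hdl Γ Σ C) → renH (ext {B = A} ρ) (renH there H) ≡ renH there (renH ρ H)
ren-ext-wkH H = ≡.trans (ren-renH (λ _ → refl) H) (≡.sym (ren-renH (λ _ → refl) H))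

ren-sub-ext : ρ ᵣ∘ₛ σ ≗ τ → ext {B = B} ρ ᵣ∘ₛ exts σ ≗ exts τ
ren-sub-ext h (here p)  = refl
ren-sub-ext {σ = σ} h (there i) = ≡.trans (ren-ext-wkV (σ i)) (cong wk (h i))

ren-subV  : ρ ᵣ∘ₛ σ ≗ τ → (V : Val Γ A) → renV ρ (subV σ V) ≡ subV τ V
ren-subVs : ρ ᵣ∘ₛ σ ≗ τ → (Vs : Vals Γ As) → renVs ρ (subVs σ Vs) ≡ subVs τ Vs
ren-subC  : ρ ᵣ∘ₛ σ ≗ τ → (M : Comp Γ C) → renC ρ (subC σ M) ≡ subC τ M
ren-subH  : ρ ᵣ∘ₛ σ ≗ τ → (H : Hdl Γ Σ C) → renH ρ (subH σ H) ≡ subH τ H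
ren-subV h (var i)    = h i
ren-subV h (ƛ M)      = cong ƛ (ren-subC (ren-sub-ext h) M)
ren-subV h ⟪ Vs ⟫     = cong ⟪_⟫ (ren-subVs h Vs)
ren-subV h (proj i V) = cong (proj i) (ren-subV h V)
ren-subVs h []       = refl
ren-subVs h (V ∷ Vs) = cong₂ _∷_ (ren-subV h V) (ren-subVs h Vs)
ren-subC h (V · W)      = cong₂ _·_ (ren-subV h V) (ren-subV h W)
ren-subC h (return V)   = cong return (ren-subV h V)
ren-subC h (letin M N)  = cong₂ letin (ren-subC h M) (ren-subC (ren-sub-ext h) N)
ren-subC h (opcall m V) = cong (opcall m) (ren-subV h V)
ren-subC h (handle M by H to N) =
  cong₃ handle_by_to_ (ren-subC h M) (ren-subH h H) (ren-subC (ren-sub-ext h) N)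
ren-subH h []           = refl
ren-subH h (clause M H) = cong₂ clause (ren-subC (ren-sub-ext (ren-sub-ext h)) M) (ren-subH h H)

ren-sub-commuteC : {σ′ : Sub Δ′ Ξ} {ρ′ : Ren Γ Δ′} → ρ ᵣ∘ₛ σ ≗ σ′ ₛ∘ᵣ ρ′ →
                   (M : Comp Γ C) → renC ρ (subC σ M) ≡ subC σ′ (renC ρ′ M)
ren-sub-commuteC h M = ≡.trans (ren-subC h M) (≡.sym (sub-renC (λ _ → refl) M))

sub-ext-wkV : (V : Val Γ B) → subV (exts {B = A} σ) (wk V) ≡ wk (subV σ V)
sub-ext-wkV V = ≡.trans (sub-renV (λ _ → refl) V) (≡.sym (ren-subV (λ _ → refl) V))

sub-ext-wkC : (M : Comp Γ C) → subC (exts {B = A} σ) (renC there M) ≡ renC there (subC σ M)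
sub-ext-wkC M = ≡.trans (sub-renC (λ _ → refl) M) (≡.sym (ren-subC (λ _ → refl) M))

sub1-wkV : (V : Val Γ A) (W : Val Γ B) → subV (sub1 V) (wk W) ≡ W
sub1-wkV V W = ≡.trans (sub-renV (λ _ → refl) W) (sub-idV (λ _ → refl) W)

sub1-wkC : (V : Val Γ A) (M : Comp Γ C) → subC (sub1 V) (renC there M) ≡ M
sub1-wkC V M = ≡.trans (sub-renC (λ _ → refl) M) (sub-idC (λ _ → refl) M)

renC-[] : (M : Comp (A ∷ Γ) C) (V : Val Γ A) → renC ρ (M [ V ]) ≡ renC (ext ρ) M [ renV ρ V ]
renC-[] {ρ = ρ} M V = ren-sub-commuteC pointwise M
  where
  pointwise : ρ ᵣ∘ₛ sub1 V ≗ sub1 (renV ρ V) ₛ∘ᵣ ext ρ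
  pointwise (here refl) = refl
  pointwise (there i)   = refl

renC-sub2 : (M : Comp (B ∷ A ∷ Γ) C) (V : Val Γ A) (K : Val Γ B) →
            renC ρ (subC (sub2 V K) M) ≡ subC (sub2 (renV ρ V) (renV ρ K)) (renC (ext (ext ρ)) M)
renC-sub2 {ρ = ρ} M V K = ren-sub-commuteC pointwise M
  where
  pointwise : ρ ᵣ∘ₛ sub2 V K ≗ sub2 (renV ρ V) (renV ρ K) ₛ∘ᵣ ext (ext ρ)
  pointwise (here refl)         = refl
  pointwise (there (here refl)) = refl
  pointwise (there (there i))   = refl

ren-ext-ext-wkC : (N : Comp (B ∷ Γ) C) →
                  renC (ext (ext {B = A} ρ)) (renC (ext there) N) ≡ renC (ext there) (renC (ext ρ) N)
ren-ext-ext-wkC {ρ = ρ} N =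
  ≡.trans (ren-renC {ρ₃ = λ i → ext there (ext ρ i)} pointwise N) (≡.sym (ren-renC (λ _ → refl) N))
  where
  pointwise : ∀ {A} (i : A ∈ _) → ext (ext ρ) (ext there i) ≡ ext there (ext ρ i)
  pointwise (here p)  = refl
  pointwise (there i) = refl

x₀≔_ : Val (A ∷ Γ) B → Sub (B ∷ Γ) (A ∷ Γ)
(x₀≔ P) (here refl) = P
(x₀≔ P) (there i)   = var (there i)

x₀≔-wkV : (P : Val (A ∷ Γ) B) (W : Val Γ D) → subV (x₀≔ P) (wk W) ≡ wk W
x₀≔-wkV P W = ≡.trans (sub-renV (λ _ → refl) W) (≡.sym (ren-as-subV (λ _ → refl) W))

ext-wk-[] : (P : Val (A ∷ Γ) B) (N : Comp (B ∷ Γ) C) → renC (ext there) N [ P ] ≡ subC (x₀≔ P) N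
ext-wk-[] P = sub-renC λ where
  (here refl) → refl
  (there i)   → refl

lookupVs-ren : (Vs : Vals Γ As) (i : A ∈ As) → renV ρ (lookupVs Vs i) ≡ lookupVs (renVs ρ Vs) i
lookupVs-ren (V ∷ Vs) (here refl) = refl
lookupVs-ren (V ∷ Vs) (there i)   = lookupVs-ren Vs i

tabulateVs-ren : ∀ As (f : ∀ {A} → A ∈ As → Val Γ A) →
                 renVs ρ (tabulateVs As f) ≡ tabulateVs As (λ i → renV ρ (f i))
tabulateVs-ren []       f = refl
tabulateVs-ren (A ∷ As) f = cong (renV _ (f (here refl)) ∷_) (tabulateVs-ren As (λ i → f (there i)))

tabulateVs-sub : ∀ As (f : ∀ {A} → A ∈ As → Val Γ A) →
                 subVs σ (tabulateVs As f) ≡ tabulateVs As (λ i → subV σ (f i))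
tabulateVs-sub []       f = refl
tabulateVs-sub (A ∷ As) f = cong (subV _ (f (here refl)) ∷_) (tabulateVs-sub As (λ i → f (there i)))

lookupVs-tabulateVs : ∀ As (f : ∀ {A} → A ∈ As → Val Γ A) (i : A ∈ As) → lookupVs (tabulateVs As f) i ≡ f i
lookupVs-tabulateVs (A ∷ As) f (here refl) = refl
lookupVs-tabulateVs (A ∷ As) f (there i)   = lookupVs-tabulateVs As (λ j → f (there j)) i

tabulateVs-lookupVs : (Vs : Vals Γ As) → tabulateVs As (lookupVs Vs) ≡ Vs
tabulateVs-lookupVs []       = refl
tabulateVs-lookupVs (V ∷ Vs) = cong (V ∷_) (tabulateVs-lookupVs Vs)

clauseOf-ren : ∀ {o} (H : Hdl Γ Σ C) (m : Σ ∋ o ↦ (A , B)) →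
               clauseOf (renH ρ H) m ≡ renC (ext (ext ρ)) (clauseOf H m)
clauseOf-ren (clause M H) here      = refl
clauseOf-ren (clause M H) (there m) = clauseOf-ren H m

≈v-reflexive : {V W : Val Γ A} → V ≡ W → V ≈v W
≈v-reflexive refl = refl

≈c-reflexive : {M N : Comp Γ C} → M ≡ N → M ≈c N
≈c-reflexive refl = refl

≈vs-refl : {Vs : Vals Γ As} → Vs ≈vs Vs
≈vs-refl {Vs = []}     = []
≈vs-refl {Vs = V ∷ Vs} = refl ∷ ≈vs-refl

≈vs-reflexive : {Vs Ws : Vals Γ As} → Vs ≡ Ws → Vs ≈vs Ws
≈vs-reflexive refl = ≈vs-refl

≈vs-trans : {Us Vs Ws : Vals Γ As} → Us ≈vs Vs → Vs ≈vs Ws → Us ≈vs Ws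
≈vs-trans []       []       = []
≈vs-trans (e ∷ es) (f ∷ fs) = trans e f ∷ ≈vs-trans es fs

tabulateVs-cong : ∀ As {f g : ∀ {A} → A ∈ As → Val Γ A} →
                  (∀ {A} (i : A ∈ As) → f i ≈v g i) → tabulateVs As f ≈vs tabulateVs As g
tabulateVs-cong []       h = []
tabulateVs-cong (A ∷ As) h = h (here refl) ∷ tabulateVs-cong As (λ i → h (there i))

≈c-setoid : Ctx → CTy → Setoid 0ℓ 0ℓ
≈c-setoid Γ C = record
  { Carrier = Comp Γ C ; _≈_ = _≈c_
  ; isEquivalence = record { refl = refl ; sym = sym ; trans = trans } }

module ≈c-Reasoning {Γ C} = SetoidReasoning (≈c-setoid Γ C)

renV-resp-≈  : (ρ : Ren Γ Δ) {V W : Val Γ A} → V ≈v W → renV ρ V ≈v renV ρ W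
renVs-resp-≈ : (ρ : Ren Γ Δ) {Vs Ws : Vals Γ As} → Vs ≈vs Ws → renVs ρ Vs ≈vs renVs ρ Ws
renC-resp-≈  : (ρ : Ren Γ Δ) {M N : Comp Γ C} → M ≈c N → renC ρ M ≈c renC ρ N
renH-resp-≈  : (ρ : Ren Γ Δ) {H K : Hdl Γ Σ C} → H ≈h K → renH ρ H ≈h renH ρ K
renV-resp-≈ ρ refl            = refl
renV-resp-≈ ρ (sym e)         = sym (renV-resp-≈ ρ e)
renV-resp-≈ ρ (trans e e′)    = trans (renV-resp-≈ ρ e) (renV-resp-≈ ρ e′)
renV-resp-≈ ρ (ƛ-cong e)      = ƛ-cong (renC-resp-≈ (ext ρ) e)
renV-resp-≈ ρ (⟪⟫-cong e)     = ⟪⟫-cong (renVs-resp-≈ ρ e)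
renV-resp-≈ ρ (proj-cong i e) = proj-cong i (renV-resp-≈ ρ e)
renV-resp-≈ ρ (∏-β i Vs) = trans (∏-β i (renVs ρ Vs)) (≈v-reflexive (≡.sym (lookupVs-ren Vs i)))
renV-resp-≈ ρ (∏-η {As = As} V) =
  trans (∏-η (renV ρ V)) (≈v-reflexive (cong ⟪_⟫ (≡.sym (tabulateVs-ren As (λ i → proj i V)))))
renV-resp-≈ ρ (⟶-η V) =
  trans (⟶-η (renV ρ V)) (≈v-reflexive (cong (λ U → ƛ (U · x₀)) (≡.sym (ren-ext-wkV V))))
renVs-resp-≈ ρ []       = []
renVs-resp-≈ ρ (e ∷ es) = renV-resp-≈ ρ e ∷ renVs-resp-≈ ρ es
renC-resp-≈ ρ refl                    = refl
renC-resp-≈ ρ (sym e)                 = sym (renC-resp-≈ ρ e)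
renC-resp-≈ ρ (trans e e′)            = trans (renC-resp-≈ ρ e) (renC-resp-≈ ρ e′)
renC-resp-≈ ρ (·-cong e e′)           = ·-cong (renV-resp-≈ ρ e) (renV-resp-≈ ρ e′)
renC-resp-≈ ρ (return-cong e)         = return-cong (renV-resp-≈ ρ e)
renC-resp-≈ ρ (letin-cong e e′)       = letin-cong (renC-resp-≈ ρ e) (renC-resp-≈ (ext ρ) e′)
renC-resp-≈ ρ (opcall-cong m e)       = opcall-cong m (renV-resp-≈ ρ e)
renC-resp-≈ ρ (handle-cong e e′ e″)   =
  handle-cong (renC-resp-≈ ρ e) (renH-resp-≈ ρ e′) (renC-resp-≈ (ext ρ) e″)
renC-resp-≈ ρ (⟶-β M V)              = trans (⟶-β _ _) (≈c-reflexive (≡.sym (renC-[] M V)))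
renC-resp-≈ ρ (let-β V M)             = trans (let-β _ _) (≈c-reflexive (≡.sym (renC-[] M V)))
renC-resp-≈ ρ (let-η M)               = let-η _
renC-resp-≈ ρ (let-assoc L M N)       =
  trans (let-assoc _ _ _) (≈c-reflexive (cong (letin _ ∘ letin _) (≡.sym (ren-ext-ext-wkC N))))
renC-resp-≈ ρ (handle-return V H M)   = trans (handle-return _ _ _) (≈c-reflexive (≡.sym (renC-[] M V)))
renC-resp-≈ ρ (handle-let L M H N)    =
  trans (handle-let _ _ _ _)
    (≈c-reflexive (cong₂ (λ H′ N′ → handle _ by _ to (handle _ by H′ to N′))
                         (≡.sym (ren-ext-wkH H)) (≡.sym (ren-ext-ext-wkC N))))
renC-resp-≈ ρ (handle-op m V H M)     =
  trans (handle-op m _ _ _)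
    (≈c-reflexive (≡.trans (cong (subC _) (clauseOf-ren H m)) (≡.sym (renC-sub2 (clauseOf H m) V (ƛ M)))))
renH-resp-≈ ρ refl                = refl
renH-resp-≈ ρ (sym e)             = sym (renH-resp-≈ ρ e)
renH-resp-≈ ρ (trans e e′)        = trans (renH-resp-≈ ρ e) (renH-resp-≈ ρ e′)
renH-resp-≈ ρ (clause-cong e e′)  = clause-cong (renC-resp-≈ (ext (ext ρ)) e) (renH-resp-≈ ρ e′)

Thunk : Sig → VTy → VTy
Thunk Σ A = ∏ [] ⟶ A ! Σ

unit : Val Γ (∏ [])
unit = ⟪ [] ⟫

force : Val Γ (Thunk Σ A) → Comp Γ (A ! Σ)
force t = t · unit

thunk : Comp Γ (A ! Σ) → Val Γ (Thunk Σ A)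
thunk M = ƛ (renC there M)

force-thunk : (M : Comp Γ (A ! Σ)) → force (thunk M) ≈c M
force-thunk M = trans (⟶-β _ _) (≈c-reflexive (sub1-wkC unit M))

thunk-force : (t : Val Γ (Thunk Σ A)) → thunk (force t) ≈v t
thunk-force t = sym (trans (⟶-η t) (ƛ-cong (·-cong refl (∏-η x₀))))

force-cong : {t u : Val Γ (Thunk Σ A)} → t ≈v u → force t ≈c force u
force-cong e = ·-cong e refl

thunk-cong : {M N : Comp Γ (A ! Σ)} → M ≈c N → thunk M ≈v thunk N
thunk-cong e = ƛ-cong (renC-resp-≈ there e)

thunk-ext : {t u : Val Γ (Thunk Σ A)} → force t ≈c force u → t ≈v u
thunk-ext {t = t} {u} e = trans (sym (thunk-force t)) (trans (thunk-cong e) (thunk-force u))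

sub-thunk : (σ : Sub Γ Δ) (M : Comp Γ (A ! Σ)) → subV σ (thunk M) ≡ thunk (subC σ M)
sub-thunk σ M = cong ƛ (sub-ext-wkC M)

let-let-return : (L : Comp Γ (A ! Σ)) (P : Val (A ∷ Γ) B) (N : Comp (B ∷ Γ) (D ! Σ)) →
                 letin (letin L (return P)) N ≈c letin L (subC (x₀≔ P) N)
let-let-return L P N =
  trans (let-assoc _ _ _) (letin-cong refl (trans (let-β _ _) (≈c-reflexive (ext-wk-[] P N))))

handle-let-return : (L : Comp Γ (A ! Σ)) (P : Val (A ∷ Γ) B) (H : Hdl Γ Σ C) (N : Comp (B ∷ Γ) C) →
                    (handle letin L (return P) by H to N) ≈c (handle L by H to subC (x₀≔ P) N)
handle-let-return L P H N =
  trans (handle-let _ _ _ _) (handle-cong refl refl (trans (handle-return _ _ _) (≈c-reflexive (ext-wk-[] P N))))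

-- A ⊗ B extends the component list of a product type B instead of nesting it, so that
-- ⟦ A ∷ As ⟧vs = ⟦ A ⟧v ⊗ ⟦ As ⟧vs is ∏ (A ∷ As) whenever ⟦ A ⟧v ≡ A and ⟦ As ⟧vs ≡ ∏ As.
infixr 7 _⊗_
_⊗_ : VTy → VTy → VTy
A ⊗ ∏ Bs    = ∏ (A ∷ Bs)
A ⊗ (B ⟶ C) = ∏ (A ∷ (B ⟶ C) ∷ [])

pair : Val Γ A → Val Γ B → Val Γ (A ⊗ B)
pair {B = ∏ Bs}  a b = ⟪ a ∷ tabulateVs Bs (λ i → proj i b) ⟫
pair {B = B ⟶ C} a b = ⟪ a ∷ b ∷ [] ⟫

fst : Val Γ (A ⊗ B) → Val Γ A
fst {B = ∏ Bs}  p = proj (here refl) p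
fst {B = B ⟶ C} p = proj (here refl) p

snd : Val Γ (A ⊗ B) → Val Γ B
snd {B = ∏ Bs}  p = ⟪ tabulateVs Bs (λ i → proj (there i) p) ⟫
snd {B = B ⟶ C} p = proj (there (here refl)) p

fst-pair : (a : Val Γ A) (b : Val Γ B) → fst (pair a b) ≈v a
fst-pair {B = ∏ Bs}  a b = ∏-β _ _
fst-pair {B = B ⟶ C} a b = ∏-β _ _

snd-pair : (a : Val Γ A) (b : Val Γ B) → snd (pair a b) ≈v b
snd-pair {B = ∏ Bs} a b =
  trans (⟪⟫-cong (tabulateVs-cong Bs λ i →
           trans (∏-β (there i) _) (≈v-reflexive (lookupVs-tabulateVs Bs (λ j → proj j b) i))))
        (sym (∏-η b))
snd-pair {B = B ⟶ C} a b = ∏-β _ _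

pair-η : (p : Val Γ (A ⊗ B)) → pair (fst p) (snd p) ≈v p
pair-η {B = ∏ Bs} p =
  trans (⟪⟫-cong (refl ∷ tabulateVs-cong Bs λ i →
           trans (∏-β i _) (≈v-reflexive (lookupVs-tabulateVs Bs (λ j → proj (there j) p) i))))
        (sym (∏-η p))
pair-η {B = B ⟶ C} p = sym (∏-η p)

pair-cong : {a a′ : Val Γ A} {b b′ : Val Γ B} → a ≈v a′ → b ≈v b′ → pair a b ≈v pair a′ b′
pair-cong {B = ∏ Bs}  ea eb = ⟪⟫-cong (ea ∷ tabulateVs-cong Bs (λ i → proj-cong i eb))
pair-cong {B = B ⟶ C} ea eb = ⟪⟫-cong (ea ∷ eb ∷ [])

fst-cong : {p q : Val Γ (A ⊗ B)} → p ≈v q → fst p ≈v fst q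
fst-cong {B = ∏ Bs}  e = proj-cong _ e
fst-cong {B = B ⟶ C} e = proj-cong _ e

snd-cong : {p q : Val Γ (A ⊗ B)} → p ≈v q → snd p ≈v snd q
snd-cong {B = ∏ Bs}  e = ⟪⟫-cong (tabulateVs-cong Bs (λ i → proj-cong _ e))
snd-cong {B = B ⟶ C} e = proj-cong _ e

sub-pair : (σ : Sub Γ Δ) (a : Val Γ A) (b : Val Γ B) → subV σ (pair a b) ≡ pair (subV σ a) (subV σ b)
sub-pair {B = ∏ Bs}  σ a b = cong (λ bs → ⟪ subV σ a ∷ bs ⟫) (tabulateVs-sub Bs (λ i → proj i b))
sub-pair {B = B ⟶ C} σ a b = refl

sub-fst : (σ : Sub Γ Δ) (p : Val Γ (A ⊗ B)) → subV σ (fst p) ≡ fst (subV σ p)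
sub-fst {B = ∏ Bs}  σ p = refl
sub-fst {B = B ⟶ C} σ p = refl

sub-snd : (σ : Sub Γ Δ) (p : Val Γ (A ⊗ B)) → subV σ (snd p) ≡ snd (subV σ p)
sub-snd {B = ∏ Bs}  σ p = cong ⟪_⟫ (tabulateVs-sub Bs (λ i → proj (there i) p))
sub-snd {B = B ⟶ C} σ p = refl

ren-pair : (ρ : Ren Γ Δ) (a : Val Γ A) (b : Val Γ B) → renV ρ (pair a b) ≡ pair (renV ρ a) (renV ρ b)
ren-pair {B = ∏ Bs}  ρ a b = cong (λ bs → ⟪ renV ρ a ∷ bs ⟫) (tabulateVs-ren Bs (λ i → proj i b))
ren-pair {B = B ⟶ C} ρ a b = refl

ren-snd : (ρ : Ren Γ Δ) (p : Val Γ (A ⊗ B)) → renV ρ (snd p) ≡ snd (renV ρ p)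
ren-snd {B = ∏ Bs}  ρ p = cong ⟪_⟫ (tabulateVs-ren Bs (λ i → proj (there i) p))
ren-snd {B = B ⟶ C} ρ p = refl

pair-⟪⟫ : (a : Val Γ A) (bs : Vals Γ As) → pair a ⟪ bs ⟫ ≈v ⟪ a ∷ bs ⟫
pair-⟪⟫ {As = As} a bs =
  ⟪⟫-cong (refl ∷ ≈vs-trans (tabulateVs-cong As (λ i → ∏-β i bs)) (≈vs-reflexive (tabulateVs-lookupVs bs)))

record Hom (X Y : VTy) : Set where
  constructor mkHom
  field
    fun  : Val Γ X → Val Γ Y
    resp : {v w : Val Γ X} → v ≈v w → fun v ≈v fun w
    nat  : (σ : Sub Γ Δ) (v : Val Γ X) → subV σ (fun v) ≈v fun (subV σ v)

  nat-ren : (ρ : Ren Γ Δ) (v : Val Γ X) → renV ρ (fun v) ≈v fun (renV ρ v)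
  nat-ren ρ v = trans (≈v-reflexive (ren-as-subV (λ _ → refl) (fun v)))
                  (trans (nat (ren⇒sub ρ) v) (resp (≈v-reflexive (≡.sym (ren-as-subV (λ _ → refl) v)))))

open Hom public

nat-wk-wk : (f : Hom X Y) (v : Val Γ X) → wk {A = A} (wk {A = B} (fun f v)) ≈v fun f (wk (wk v))
nat-wk-wk f v = trans (renV-resp-≈ there (nat-ren f there v)) (nat-ren f there (wk v))

infix 4 _≈H_
_≈H_ : ∀ {X Y} → Hom X Y → Hom X Y → Set
_≈H_ {X} f g = ∀ {Γ} (v : Val Γ X) → fun f v ≈v fun g v

idH : ∀ {X} → Hom X X
idH = mkHom (λ v → v) (λ e → e) (λ σ v → refl)

infixr 9 _∘H_
_∘H_ : ∀ {X Y Z} → Hom Y Z → Hom X Y → Hom X Z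
f ∘H g = mkHom (λ v → fun f (fun g v)) (λ e → resp f (resp g e))
               (λ σ v → trans (nat f σ (fun g v)) (resp f (nat g σ v)))

thunkHom : ∀ {X Y} (M : ∀ {Γ} → Val Γ X → Comp Γ (Y ! Σ)) →
           (∀ {Γ} {v w : Val Γ X} → v ≈v w → M v ≈c M w) →
           (∀ {Γ Δ} (σ : Sub Γ Δ) (v : Val Γ X) → subC σ (M v) ≈c M (subV σ v)) →
           Hom X (Thunk Σ Y)
thunkHom M resp-M nat-M = mkHom (λ v → thunk (M v)) (λ e → thunk-cong (resp-M e))
  (λ σ v → trans (≈v-reflexive (sub-thunk σ (M v))) (thunk-cong (nat-M σ v)))

TermCat : Category
TermCat = record
  { Obj = VTy
  ; _⇒_ = Hom
  ; _≈_ = _≈H_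
  ; id = idH
  ; _∘_ = _∘H_
  ; ≈-equiv = record { refl = λ v → refl ; sym = λ e v → sym (e v) ; trans = λ e e′ v → trans (e v) (e′ v) }
  ; ∘-resp-≈ = λ {_} {_} {_} {f} {h} {g} {i} e e′ v → trans (resp f (e′ v)) (e (fun i v))
  ; identityˡ = λ v → refl
  ; identityʳ = λ v → refl
  ; assoc = λ v → refl
  }

fstH : Hom (A ⊗ B) A
fstH = mkHom fst fst-cong (λ σ v → ≈v-reflexive (sub-fst σ v))

sndH : Hom (A ⊗ B) B
sndH = mkHom snd snd-cong (λ σ v → ≈v-reflexive (sub-snd σ v))

⟨_,_⟩H : ∀ {X} → Hom X A → Hom X B → Hom X (A ⊗ B)
⟨ f , g ⟩H = mkHom (λ v → pair (fun f v) (fun g v)) (λ e → pair-cong (resp f e) (resp g e))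
  (λ σ v → trans (≈v-reflexive (sub-pair σ (fun f v) (fun g v))) (pair-cong (nat f σ v) (nat g σ v)))

TermCartesian : Cartesian TermCat
TermCartesian = record
  { 𝟙 = ∏ []
  ; ! = mkHom (λ _ → unit) (λ _ → refl) (λ σ v → refl)
  ; !-unique = λ f v → ∏-η (fun f v)
  ; _⊗_ = _⊗_
  ; π₁ = fstH
  ; π₂ = sndH
  ; ⟨_,_⟩ = ⟨_,_⟩H
  ; project₁ = λ {_} {_} {_} {f} {g} v → fst-pair (fun f v) (fun g v)
  ; project₂ = λ {_} {_} {_} {f} {g} v → snd-pair (fun f v) (fun g v)
  ; ⟨⟩-unique = λ {_} {_} {_} {f} {g} {h} e e′ v →
      trans (pair-cong (sym (e v)) (sym (e′ v))) (pair-η (fun h v))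
  }

infixr 8 _⁂H_
_⁂H_ : ∀ {A B A′ B′} → Hom A A′ → Hom B B′ → Hom (A ⊗ B) (A′ ⊗ B′)
f ⁂H g = ⟨ f ∘H fstH , g ∘H sndH ⟩H

swapH : Hom (A ⊗ B) (B ⊗ A)
swapH {A} {B} = ⟨ sndH {A} {B} , fstH ⟩H

αH : Hom ((A ⊗ B) ⊗ D) (A ⊗ (B ⊗ D))
αH {A} {B} {D} = ⟨ fstH ∘H fstH {B = D} , ⟨ sndH {A} {B} ∘H fstH {B = D} , sndH ⟩H ⟩H

module TermMonad (S : Sig) where
  open ≈c-Reasoning

  ηH : Hom A (Thunk S A)
  ηH = thunkHom return return-cong (λ σ v → refl)

  T₁H : Hom A B → Hom (Thunk S A) (Thunk S B)
  T₁H f = thunkHom (λ t → letin (force t) (return (fun f x₀)))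
                   (λ e → letin-cong (force-cong e) refl)
                   (λ σ t → letin-cong refl (return-cong (nat f (exts σ) x₀)))

  μH : Hom (Thunk S (Thunk S A)) (Thunk S A)
  μH = thunkHom (λ t → letin (force t) (force x₀)) (λ e → letin-cong (force-cong e) refl) (λ σ t → refl)

  stH : ∀ {A B} → Hom (A ⊗ Thunk S B) (Thunk S (A ⊗ B))
  stH {A} {B} = thunkHom stC
    (λ e → letin-cong (force-cong (snd-cong {B = Thunk S B} e))
                      (return-cong (pair-cong (renV-resp-≈ there (fst-cong {B = Thunk S B} e)) refl)))
    (λ σ p → ≈c-reflexive (sub-stC σ p))
    where
    stC : Val Γ (A ⊗ Thunk S B) → Comp Γ ((A ⊗ B) ! S)
    stC p = letin (force (snd {B = Thunk S B} p)) (return (pair {B = B} (wk (fst {B = Thunk S B} p)) x₀))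

    sub-stC : (σ : Sub Γ Δ) (p : Val Γ (A ⊗ Thunk S B)) → subC σ (stC p) ≡ stC (subV σ p)
    sub-stC σ p = cong (λ r → letin (force (subV σ (snd {B = Thunk S B} p))) (return r))
      (≡.trans (sub-pair (exts σ) (wk (fst {B = Thunk S B} p)) x₀)
               (cong (λ a → pair a x₀) (sub-ext-wkV (fst {B = Thunk S B} p))))

  force-η : (v : Val Γ A) → force (fun ηH v) ≈c return v
  force-η v = force-thunk _

  force-T₁ : (f : Hom A B) {t : Val Γ (Thunk S A)} {L : Comp Γ (D ! S)} {P : Val (D ∷ Γ) A} →
             force t ≈c letin L (return P) → force (fun (T₁H f) t) ≈c letin L (return (fun f P))
  force-T₁ f {t} {L} {P} e = begin
    force (fun (T₁H f) t)                             ≈⟨ force-thunk _ ⟩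
    letin (force t) (return (fun f x₀))               ≈⟨ letin-cong e refl ⟩
    letin (letin L (return P)) (return (fun f x₀))    ≈⟨ let-let-return L P _ ⟩
    letin L (return (subV (x₀≔ P) (fun f x₀)))        ≈⟨ letin-cong refl (return-cong (nat f (x₀≔ P) x₀)) ⟩
    letin L (return (fun f P))                        ∎

  force-μ : {t : Val Γ (Thunk S (Thunk S A))} {L : Comp Γ (D ! S)} {P : Val (D ∷ Γ) (Thunk S A)} →
            force t ≈c letin L (return P) → force (fun μH t) ≈c letin L (force P)
  force-μ {t = t} {L} {P} e = begin
    force (fun μH t)                        ≈⟨ force-thunk _ ⟩
    letin (force t) (force x₀)              ≈⟨ letin-cong e refl ⟩
    letin (letin L (return P)) (force x₀)   ≈⟨ let-let-return L P _ ⟩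
    letin L (force P)                       ∎

  force-st : (p : Val Γ (A ⊗ Thunk S B)) {a : Val Γ A} {M : Comp Γ (B ! S)} →
             fst {B = Thunk S B} p ≈v a → force (snd {B = Thunk S B} p) ≈c M →
             force (fun stH p) ≈c letin M (return (pair {B = B} (wk a) x₀))
  force-st p ea eM = trans (force-thunk _) (letin-cong eM (return-cong (pair-cong (renV-resp-≈ there ea) refl)))

  force-st-let : (p : Val Γ (A ⊗ Thunk S B)) {a : Val Γ A} {L : Comp Γ (D ! S)} {P : Val (D ∷ Γ) B} →
                 fst {B = Thunk S B} p ≈v a → force (snd {B = Thunk S B} p) ≈c letin L (return P) →
                 force (fun stH p) ≈c letin L (return (pair (wk a) P))
  force-st-let p {a} {L} {P} ea eM = begin
    force (fun stH p)
      ≈⟨ force-st p ea eM ⟩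
    letin (letin L (return P)) (return (pair (wk a) x₀))
      ≈⟨ let-let-return L P _ ⟩
    letin L (return (subV (x₀≔ P) (pair (wk a) x₀)))
      ≡⟨ cong (letin L ∘ return) (sub-pair (x₀≔ P) (wk a) x₀) ⟩
    letin L (return (pair (subV (x₀≔ P) (wk a)) P))
      ≡⟨ cong (λ a′ → letin L (return (pair a′ P))) (x₀≔-wkV P a) ⟩
    letin L (return (pair (wk a) P))
      ∎

  force-T₁-st : (N : Hom (D ⊗ A) B) (γ : Val Γ D) (m : Val Γ (Thunk S A)) →
                force (fun (T₁H N) (fun stH (pair γ m))) ≈c letin (force m) (return (fun N (pair (wk γ) x₀)))
  force-T₁-st N γ m = force-T₁ N (force-st (pair γ m) (fst-pair γ m) (force-cong (snd-pair γ m)))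

  T₁-resp : {f g : Hom A B} → f ≈H g → T₁H f ≈H T₁H g
  T₁-resp e t = thunk-cong (letin-cong refl (return-cong (e x₀)))

  T₁-id : T₁H (idH {A}) ≈H idH
  T₁-id t = trans (thunk-cong (let-η _)) (thunk-force t)

  T₁-∘ : {f : Hom A B} {g : Hom B D} → T₁H (g ∘H f) ≈H T₁H g ∘H T₁H f
  T₁-∘ {g = g} t = thunk-ext (trans (force-thunk _) (sym (force-T₁ g (force-thunk _))))

  η-nat : {f : Hom A B} → T₁H f ∘H ηH ≈H ηH ∘H f
  η-nat {f = f} v = thunk-ext (begin
    force (fun (T₁H f) (fun ηH v))         ≈⟨ force-T₁ f (trans (force-η v) (sym (let-β v _))) ⟩
    letin (return v) (return (fun f x₀))   ≈⟨ let-β _ _ ⟩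
    return (subV (sub1 v) (fun f x₀))      ≈⟨ return-cong (nat f (sub1 v) x₀) ⟩
    return (fun f v)                       ≈⟨ force-η _ ⟨
    force (fun ηH (fun f v))               ∎)

  μ-nat : {f : Hom A B} → T₁H f ∘H μH ≈H μH ∘H T₁H (T₁H f)
  μ-nat {f = f} t = thunk-ext (begin
    force (fun (T₁H f) (fun μH t))                          ≈⟨ force-thunk _ ⟩
    letin (force (fun μH t)) (return (fun f x₀))            ≈⟨ letin-cong (force-thunk _) refl ⟩
    letin (letin (force t) (force x₀)) (return (fun f x₀))  ≈⟨ let-assoc _ _ _ ⟩
    letin (force t) (letin (force x₀) (return (renV (ext there) (fun f x₀))))
      ≈⟨ letin-cong refl (letin-cong refl (return-cong (nat-ren f (ext there) x₀))) ⟩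
    letin (force t) (letin (force x₀) (return (fun f x₀)))  ≈⟨ letin-cong refl (force-thunk _) ⟨
    letin (force t) (force (fun (T₁H f) x₀))                ≈⟨ force-μ (force-thunk _) ⟨
    force (fun μH (fun (T₁H (T₁H f)) t))                    ∎)

  μ-η : μH ∘H ηH ≈H idH {Thunk S A}
  μ-η t = thunk-ext (trans (force-thunk _) (trans (letin-cong (force-η t) refl) (let-β _ _)))

  μ-Tη : μH ∘H T₁H ηH ≈H idH {Thunk S A}
  μ-Tη t = thunk-ext (trans (force-μ (force-thunk _)) (trans (letin-cong refl (force-η x₀)) (let-η _)))

  μ-assoc : μH ∘H T₁H μH ≈H μH ∘H μH {Thunk S A}
  μ-assoc t = thunk-ext (begin
    force (fun μH (fun (T₁H μH) t))                    ≈⟨ force-μ (force-thunk _) ⟩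
    letin (force t) (force (fun μH x₀))                ≈⟨ letin-cong refl (force-thunk _) ⟩
    letin (force t) (letin (force x₀) (force x₀))      ≈⟨ let-assoc _ _ _ ⟨
    letin (letin (force t) (force x₀)) (force x₀)      ≈⟨ letin-cong (force-thunk _) refl ⟨
    letin (force (fun μH t)) (force x₀)                ≈⟨ force-thunk _ ⟨
    force (fun μH (fun μH t))                          ∎)

  st-nat : ∀ {A B A′ B′} {f : Hom A A′} {g : Hom B B′} → T₁H (f ⁂H g) ∘H stH ≈H stH ∘H (f ⁂H T₁H g)
  st-nat {B = B} {f = f} {g} p = thunk-ext (begin
    force (fun (T₁H (f ⁂H g)) (fun stH p))
      ≈⟨ force-T₁ (f ⁂H g) (force-st p refl refl) ⟩
    letin (force b) (return (fun (f ⁂H g) (pair (wk a) x₀)))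
      ≈⟨ letin-cong refl (return-cong (pair-cong (resp f (fst-pair _ _)) (resp g (snd-pair _ _)))) ⟩
    letin (force b) (return (pair (fun f (wk a)) (fun g x₀)))
      ≈⟨ letin-cong refl (return-cong (pair-cong (nat-ren f there a) refl)) ⟨
    letin (force b) (return (pair (wk (fun f a)) (fun g x₀)))
      ≈⟨ force-st-let (pair (fun f a) (fun (T₁H g) b)) (fst-pair (fun f a) (fun (T₁H g) b))
                      (trans (force-cong (snd-pair _ _)) (force-thunk _)) ⟨
    force (fun stH (fun (f ⁂H T₁H g) p))
      ∎)
    where
    a = fst {B = Thunk S B} p
    b = snd {B = Thunk S B} p

  st-unit : T₁H sndH ∘H stH ≈H sndH {∏ []} {Thunk S A}
  st-unit {A} p = thunk-ext (begin
    force (fun (T₁H sndH) (fun stH p))                  ≈⟨ force-T₁ sndH (force-st p refl refl) ⟩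
    letin (force b) (return (snd (pair (wk a) x₀)))     ≈⟨ letin-cong refl (return-cong (snd-pair _ _)) ⟩
    letin (force b) (return x₀)                         ≈⟨ let-η _ ⟩
    force b                                             ∎)
    where
    a = fst {B = Thunk S A} p
    b = snd {B = Thunk S A} p

  st-η : stH ∘H (idH ⁂H ηH) ≈H ηH {A ⊗ B}
  st-η {A} {B} p = thunk-ext (begin
    force (fun stH (pair a (fun ηH b)))
      ≈⟨ force-st _ (fst-pair a (fun ηH b)) (trans (force-cong (snd-pair _ _)) (force-η b)) ⟩
    letin (return b) (return (pair (wk a) x₀))   ≈⟨ let-β _ _ ⟩
    return (subV (sub1 b) (pair (wk a) x₀))      ≡⟨ cong return (sub-pair (sub1 b) (wk a) x₀) ⟩
    return (pair (subV (sub1 b) (wk a)) b)       ≡⟨ cong (λ a′ → return (pair a′ b)) (sub1-wkV b a) ⟩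
    return (pair a b)                            ≈⟨ return-cong (pair-η p) ⟩
    return p                                     ≈⟨ force-η p ⟨
    force (fun ηH p)                             ∎)
    where
    a = fst {B = B} p
    b = snd {B = B} p

  st-assoc : T₁H (αH {A} {B} {D}) ∘H stH ≈H stH ∘H (idH ⁂H stH) ∘H αH {A} {B} {Thunk S D}
  st-assoc {A} {B} {D} p = thunk-ext (begin
    force (fun (T₁H (αH {A} {B} {D})) (fun stH p))
      ≈⟨ force-T₁ (αH {A} {B} {D}) (force-st p refl refl) ⟩
    letin (force c) (return (fun (αH {A} {B} {D}) (pair (wk ab) x₀)))
      ≈⟨ letin-cong refl (return-cong α-pair) ⟩
    letin (force c) (return (pair (wk a) (pair (wk b) x₀)))
      ≈⟨ force-st-let q q₁ q₂ ⟨
    force (fun stH q)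
      ∎)
    where
    ab : Val _ (A ⊗ B)
    ab = fst {B = Thunk S D} p
    c : Val _ (Thunk S D)
    c = snd {B = Thunk S D} p
    a : Val _ A
    a = fst {B = B} ab
    b : Val _ B
    b = snd {B = B} ab
    q : Val _ (A ⊗ Thunk S (B ⊗ D))
    q = fun ((idH ⁂H stH) ∘H αH {A} {B} {Thunk S D}) p

    α-pair : fun (αH {A} {B} {D}) (pair (wk ab) x₀) ≈v pair (wk a) (pair (wk b) x₀)
    α-pair = pair-cong (trans (fst-cong {B = B} (fst-pair (wk ab) x₀)) (sym (nat-ren fstH there ab)))
                       (pair-cong (trans (snd-cong {B = B} (fst-pair (wk ab) x₀)) (sym (nat-ren sndH there ab)))
                                  (snd-pair (wk ab) x₀))

    q₁ : fst {B = Thunk S (B ⊗ D)} q ≈v a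
    q₁ = trans (fst-pair {B = Thunk S (B ⊗ D)} _ _) (fst-pair a (pair b c))

    q₂ : force (snd {B = Thunk S (B ⊗ D)} q) ≈c letin (force c) (return (pair (wk b) x₀))
    q₂ = trans (force-cong (snd-pair _ _))
               (force-st _ (trans (fst-cong {B = Thunk S D} (snd-pair a (pair b c))) (fst-pair b c))
                           (force-cong (trans (snd-cong {B = Thunk S D} (snd-pair a (pair b c))) (snd-pair b c))))

  st-μ : stH ∘H (idH ⁂H μH) ≈H μH ∘H T₁H stH ∘H stH {A} {Thunk S B}
  st-μ {A} {B} p = thunk-ext (begin
    force (fun stH (pair a (fun μH t)))
      ≈⟨ force-st _ (fst-pair a (fun μH t)) (trans (force-cong (snd-pair _ _)) (force-thunk _)) ⟩
    letin (letin (force t) (force x₀)) (return (pair (wk a) x₀))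
      ≈⟨ let-assoc _ _ _ ⟩
    letin (force t) (letin (force x₀) (return (renV (ext there) (pair (wk a) x₀))))
      ≡⟨ cong (λ r → letin (force t) (letin (force x₀) (return r)))
              (≡.trans (ren-pair (ext there) (wk a) x₀) (cong (λ a′ → pair a′ x₀) (ren-ext-wkV a))) ⟩
    letin (force t) (letin (force x₀) (return (pair (wk (wk a)) x₀)))
      ≈⟨ letin-cong refl (force-st _ (fst-pair (wk a) x₀) (force-cong (snd-pair (wk a) x₀))) ⟨
    letin (force t) (force (fun stH (pair (wk a) x₀)))
      ≈⟨ force-μ (force-T₁ stH (force-st p refl refl)) ⟨
    force (fun μH (fun (T₁H stH) (fun stH p)))
      ∎)
    where
    a : Val _ A
    a = fst {B = Thunk S (Thunk S B)} p
    t : Val _ (Thunk S (Thunk S B))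
    t = snd {B = Thunk S (Thunk S B)} p

  monad : StrongMonad TermCat TermCartesian
  monad = record
    { T = Thunk S
    ; T₁ = T₁H
    ; T₁-resp = λ {_} {_} {f} {g} → T₁-resp {f = f} {g}
    ; T₁-id = T₁-id
    ; T₁-∘ = λ {_} {_} {_} {f} {g} → T₁-∘ {f = f} {g}
    ; η = ηH
    ; μ = μH
    ; η-nat = λ {_} {_} {f} → η-nat {f = f}
    ; μ-nat = λ {_} {_} {f} → μ-nat {f = f}
    ; μ-η = μ-η
    ; μ-Tη = μ-Tη
    ; μ-assoc = μ-assoc
    ; st = stH
    ; st-nat = λ {_} {_} {_} {_} {f} {g} → st-nat {f = f} {g}
    ; st-unit = st-unit
    ; st-assoc = st-assoc
    ; st-η = st-η
    ; st-μ = st-μ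
    }

  evH : Hom ((B ⟶ D ! S) ⊗ B) (Thunk S D)
  evH {B} = thunkHom (λ p → fst {B = B} p · snd {B = B} p)
                     (λ e → ·-cong (fst-cong {B = B} e) (snd-cong {B = B} e))
                     (λ σ p → ≈c-reflexive (cong₂ _·_ (sub-fst σ p) (sub-snd σ p)))

  ΛH : Hom (A ⊗ B) (Thunk S D) → Hom A (B ⟶ D ! S)
  ΛH {A} {B} f = mkHom (λ v → ƛ (force (fun f (pair {B = B} (wk v) x₀))))
    (λ e → ƛ-cong (force-cong (resp f (pair-cong (renV-resp-≈ there e) refl))))
    (λ σ v → ƛ-cong (force-cong (trans (nat f (exts σ) (pair (wk v) x₀))
      (resp f (≈v-reflexive (≡.trans (sub-pair (exts σ) (wk v) x₀) (cong (λ a → pair a x₀) (sub-ext-wkV v))))))))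

  ΛH-β : (f : Hom (A ⊗ B) (Thunk S D)) (a : Val Γ A) (b : Val Γ B) → fun (ΛH f) a · b ≈c force (fun f (pair a b))
  ΛH-β f a b = trans (⟶-β _ _) (force-cong (trans (nat f (sub1 b) (pair (wk a) x₀))
    (resp f (≈v-reflexive (≡.trans (sub-pair (sub1 b) (wk a) x₀) (cong (λ a′ → pair a′ b) (sub1-wkV b a)))))))

  Λ-β : {f : Hom (A ⊗ B) (Thunk S D)} → evH ∘H (ΛH f ⁂H idH) ≈H f
  Λ-β {A} {B} {f = f} p = thunk-ext (begin
    force (fun evH (pair (fun (ΛH f) a) b))   ≈⟨ force-thunk _ ⟩
    fst (pair (fun (ΛH f) a) b) · snd (pair (fun (ΛH f) a) b)
                                              ≈⟨ ·-cong (fst-pair _ b) (snd-pair _ b) ⟩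
    fun (ΛH f) a · b                          ≈⟨ ΛH-β f a b ⟩
    force (fun f (pair a b))                  ≈⟨ force-cong (resp f (pair-η p)) ⟩
    force (fun f p)                           ∎)
    where
    a : Val _ A
    a = fst {B = B} p
    b : Val _ B
    b = snd {B = B} p

  Λ-unique : {f : Hom (A ⊗ B) (Thunk S D)} {g : Hom A (B ⟶ D ! S)} →
             evH ∘H (g ⁂H idH) ≈H f → g ≈H ΛH f
  Λ-unique {A} {B} {f = f} {g} e v = trans (⟶-η (fun g v)) (ƛ-cong (begin
    wk (fun g v) · x₀                       ≈⟨ ·-cong (nat-ren g there v) refl ⟩
    fun g (wk v) · x₀                       ≈⟨ force-ev ⟨
    force (fun (evH ∘H (g ⁂H idH)) P)       ≈⟨ force-cong (e P) ⟩
    force (fun f P)                         ∎))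
    where
    P : Val _ (A ⊗ B)
    P = pair (wk v) x₀
    force-ev : force (fun (evH ∘H (g ⁂H idH)) P) ≈c fun g (wk v) · x₀
    force-ev = trans (force-thunk _) (·-cong (trans (fst-pair _ _) (resp g (fst-pair (wk v) x₀)))
                                             (trans (snd-pair _ _) (snd-pair (wk v) x₀)))

  kexp : KleisliExp monad
  kexp = record
    { _⇛_ = λ Y Z → Y ⟶ Z ! S
    ; ev = evH
    ; Λ = ΛH
    ; Λ-β = λ {_} {_} {_} {f} → Λ-β {f = f}
    ; Λ-unique = λ {_} {_} {_} {f} {g} → Λ-unique {f = f} {g}
    }

TermPreModel : PreModel
TermPreModel = record { 𝒞 = TermCat ; cart = TermCartesian ; monad = TermMonad.monad ; kexp = TermMonad.kexp }

open PreModelOps TermPreModel using (Hobj; hproj)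

x₁ : Val (B ∷ A ∷ Γ) A
x₁ = var (there (here refl))

hdlOf : ∀ S {S′ X} → Val Γ (Hobj S S′ X) → Hdl Γ S (X ! S′)
hdlOf []                  h = []
hdlOf ((g , (A , B)) ∷ S) {S′} {X} h =
  clause (fst {B = Hobj S S′ X} (wk (wk h)) · pair {B = B ⟶ X ! S′} x₁ x₀) (hdlOf S (snd {B = Hobj S S′ X} h))

hdlOf-cong : ∀ S {S′ X} {h h′ : Val Γ (Hobj S S′ X)} → h ≈v h′ → hdlOf S h ≈h hdlOf S h′
hdlOf-cong []                  e = refl
hdlOf-cong ((g , (A , B)) ∷ S) {S′} {X} e =
  clause-cong (·-cong (fst-cong {B = Hobj S S′ X} (renV-resp-≈ there (renV-resp-≈ there e))) refl)
              (hdlOf-cong S (snd-cong {B = Hobj S S′ X} e))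

sub-hdlOf : ∀ S {S′ X} (σ : Sub Γ Δ) (h : Val Γ (Hobj S S′ X)) → subH σ (hdlOf S h) ≡ hdlOf S (subV σ h)
sub-hdlOf []                  σ h = refl
sub-hdlOf ((g , (A , B)) ∷ S) {S′} {X} σ h =
  cong₂ clause
    (cong₂ _·_ (≡.trans (sub-fst {B = Hobj S S′ X} (exts (exts σ)) (wk (wk h)))
                        (cong fst (≡.trans (sub-ext-wkV (wk h)) (cong wk (sub-ext-wkV h)))))
               (sub-pair (exts (exts σ)) x₁ x₀))
    (≡.trans (sub-hdlOf S σ (snd h)) (cong (hdlOf S) (sub-snd {B = Hobj S S′ X} σ h)))

ren-hdlOf : ∀ S {S′ X} (ρ : Ren Γ Δ) (h : Val Γ (Hobj S S′ X)) → renH ρ (hdlOf S h) ≡ hdlOf S (renV ρ h)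
ren-hdlOf S ρ h =
  ≡.trans (ren-as-subH (λ _ → refl) (hdlOf S h))
          (≡.trans (sub-hdlOf S (ren⇒sub ρ) h) (cong (hdlOf S) (≡.sym (ren-as-subV (λ _ → refl) h))))

clauseOf-hdlOf : ∀ {S S′ X o} (m : S ∋ o ↦ (A , B)) (h : Val Γ (Hobj S S′ X)) →
                 clauseOf (hdlOf S h) m ≡ fun (hproj {S} {S′} {X} m) (wk (wk h)) · pair {B = B ⟶ X ! S′} x₁ x₀
clauseOf-hdlOf here h = refl
clauseOf-hdlOf {S = (g , (A′ , B′)) ∷ S} {S′} {X} (there m) h =
  ≡.trans (clauseOf-hdlOf m (snd {B = Hobj S S′ X} h))
          (cong (λ h′ → fun (hproj m) h′ · pair x₁ x₀)
                (≡.trans (cong wk (ren-snd {B = Hobj S S′ X} there h)) (ren-snd {B = Hobj S S′ X} there (wk h))))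

sub2-wk-wk : (a : Val Γ A) (k : Val Γ B) (h : Val Γ D) → subV (sub2 a k) (wk (wk h)) ≡ h
sub2-wk-wk a k h =
  ≡.trans (sub-renV (λ _ → refl) (wk h)) (≡.trans (sub-renV (λ _ → refl) h) (sub-idV (λ _ → refl) h))

opH : ∀ {S o} → S ∋ o ↦ (A , B) → Hom A (Thunk S B)
opH m = thunkHom (opcall m) (opcall-cong m) (λ σ v → refl)

module TermHandle (S S′ : Sig) (X : VTy) where
  open TermMonad S using (ηH; μH; T₁H; stH; force-η; force-T₁; force-st)
  open TermMonad S′ using (evH)
  open ≈c-Reasoning

  Clauses : VTy
  Clauses = Hobj S S′ X

  Handled : VTy
  Handled = Thunk S (Thunk S′ X)

  H[_] : Val Γ Clauses → Hdl Γ S (X ! S′)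
  H[_] = hdlOf S

  clausesOf : Val Γ (Clauses ⊗ Handled) → Val Γ Clauses
  clausesOf = fst {B = Handled}

  handledOf : Val Γ (Clauses ⊗ Handled) → Val Γ Handled
  handledOf = snd {B = Handled}

  handleH : Hom (Clauses ⊗ Handled) (Thunk S′ X)
  handleH = thunkHom (λ p → handle force (handledOf p) by H[ clausesOf p ] to force x₀)
    (λ e → handle-cong (force-cong (snd-cong {B = Handled} e)) (hdlOf-cong S (fst-cong {B = Handled} e)) refl)
    (λ σ p → ≈c-reflexive (cong (λ H → handle force (subV σ (handledOf p)) by H to force x₀)
                                (sub-hdlOf S σ (clausesOf p))))

  force-handle : (p : Val Γ (Clauses ⊗ Handled)) {h : Val Γ Clauses} {M : Comp Γ (Thunk S′ X ! S)} →
                 clausesOf p ≈v h → force (handledOf p) ≈c M →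
                 force (fun handleH p) ≈c (handle M by H[ h ] to force x₀)
  force-handle p eh eM = trans (force-thunk _) (handle-cong eM (hdlOf-cong S eh) refl)

  handleH-η : handleH ∘H (idH ⁂H ηH) ≈H sndH
  handleH-η p = thunk-ext (trans (force-handle _ (fst-pair h (fun ηH b)) (trans (force-cong (snd-pair h _)) (force-η b)))
                                (handle-return _ _ _))
    where
    h : Val _ Clauses
    h = fst {B = Thunk S′ X} p
    b : Val _ (Thunk S′ X)
    b = snd {B = Thunk S′ X} p

  handleH-μ : handleH ∘H (idH ⁂H μH)
                ≈H handleH ∘H (idH ⁂H T₁H handleH) ∘H ⟨ fstH {B = Thunk S Handled} , stH ⟩H
  handleH-μ p = thunk-ext (begin
    force (fun handleH (pair h (fun μH t)))
      ≈⟨ force-handle _ (fst-pair h (fun μH t)) (trans (force-cong (snd-pair h _)) (force-thunk _)) ⟩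
    (handle letin (force t) (force x₀) by H[ h ] to force x₀)
      ≈⟨ handle-let _ _ _ _ ⟩
    (handle force t by H[ h ] to (handle force x₀ by renH there H[ h ] to force x₀))
      ≡⟨ cong (λ H → handle force t by H[ h ] to (handle force x₀ by H to force x₀)) (ren-hdlOf S there h) ⟩
    (handle force t by H[ h ] to (handle force x₀ by H[ wk h ] to force x₀))
      ≈⟨ handle-cong refl refl (force-handle _ (fst-pair (wk h) x₀) (force-cong (snd-pair (wk h) x₀))) ⟨
    (handle force t by H[ h ] to force (fun handleH (pair (wk h) x₀)))
      ≈⟨ handle-let-return _ _ _ _ ⟨
    (handle letin (force t) (return (fun handleH (pair (wk h) x₀))) by H[ h ] to force x₀)
      ≈⟨ force-handle q (trans (fst-pair {B = Handled} _ _) (fst-pair h (fun stH p)))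
                        (trans (force-cong (trans (snd-pair {B = Handled} _ _)
                                                  (resp (T₁H handleH) (snd-pair h (fun stH p)))))
                               (force-T₁ handleH (force-st p refl refl))) ⟨
    force (fun handleH q)
      ∎)
    where
    h : Val _ Clauses
    h = fst {B = Thunk S (Thunk S (Thunk S′ X))} p
    t : Val _ (Thunk S (Thunk S (Thunk S′ X)))
    t = snd {B = Thunk S (Thunk S (Thunk S′ X))} p
    q : Val _ (Clauses ⊗ Handled)
    q = fun ((idH ⁂H T₁H handleH) ∘H ⟨ fstH {B = Thunk S Handled} , stH ⟩H) p

  handleH-op : ∀ {o A B} (m : S ∋ o ↦ (A , B)) →
              handleH ∘H (idH ⁂H (T₁H evH ∘H stH ∘H swapH {Thunk S B} ∘H (opH m ⁂H idH {B ⟶ X ! S′})))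
                ≈H evH ∘H (hproj {S} {S′} {X} m ⁂H idH {A ⊗ (B ⟶ X ! S′)})
  handleH-op {A = A} {B} m p = thunk-ext (begin
    force (fun handleH (pair h φ))
      ≈⟨ force-handle _ (fst-pair h φ) (trans (force-cong (snd-pair h φ)) force-φ) ⟩
    (handle letin (opcall m a) (return E) by H[ h ] to force x₀)
      ≈⟨ handle-let-return _ _ _ _ ⟩
    (handle opcall m a by H[ h ] to force E)
      ≈⟨ handle-cong refl refl force-E ⟩
    (handle opcall m a by H[ h ] to (wk k · x₀))
      ≈⟨ handle-op m a _ _ ⟩
    subC σₖ (clauseOf H[ h ] m)
      ≡⟨ cong (subC σₖ) (clauseOf-hdlOf m h) ⟩
    subV σₖ (fun (hproj m) (wk (wk h))) · subV σₖ (pair x₁ x₀)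
      ≈⟨ ·-cong (trans (nat (hproj m) σₖ (wk (wk h))) (resp (hproj m) (≈v-reflexive (sub2-wk-wk a _ h))))
                (≈v-reflexive (sub-pair σₖ x₁ x₀)) ⟩
    fun (hproj m) h · pair a (ƛ (wk k · x₀))
      ≈⟨ ·-cong refl (pair-cong refl (sym (⟶-η k))) ⟩
    fun (hproj m) h · pair a k
      ≈⟨ ·-cong refl (pair-η {B = K} u) ⟩
    fun (hproj m) h · u
      ≈⟨ trans (force-thunk _) (·-cong (fst-pair _ u) (snd-pair _ u)) ⟨
    force (fun (evH ∘H (hproj m ⁂H idH {A ⊗ K})) p)
      ∎)
    where
    K : VTy
    K = B ⟶ X ! S′
    h : Val _ Clauses
    h = fst {B = A ⊗ K} p
    u : Val _ (A ⊗ K)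
    u = snd {B = A ⊗ K} p
    a : Val _ A
    a = fst {B = K} u
    k : Val _ K
    k = snd {B = K} u
    φ : Val _ Handled
    φ = fun (T₁H evH ∘H stH ∘H swapH {Thunk S B} ∘H (opH m ⁂H idH {K})) u
    E : Val (B ∷ _) (Thunk S′ X)
    E = fun evH (pair (wk k) x₀)
    σₖ : Sub (K ∷ A ∷ _) _
    σₖ = sub2 a (ƛ (wk k · x₀))

    force-φ : force φ ≈c letin (opcall m a) (return E)
    force-φ = force-T₁ evH (force-st _ (trans (fst-pair {B = Thunk S B} _ _) (snd-pair (fun (opH m) a) k))
                                       (trans (force-cong (trans (snd-pair {B = Thunk S B} _ _) (fst-pair _ k)))
                                              (force-thunk _)))

    force-E : force E ≈c wk k · x₀
    force-E = trans (force-thunk _) (·-cong (fst-pair (wk k) x₀) (snd-pair (wk k) x₀))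

TermModel : Model TermPreModel
TermModel = record
  { ⟦op⟧      = λ S → opH
  ; handle    = TermHandle.handleH
  ; handle-η  = TermHandle.handleH-η
  ; handle-μ  = TermHandle.handleH-μ
  ; handle-op = TermHandle.handleH-op
  }

open Interp TermModel

cong-⟶ : X ≡ A → Y ≡ B → S ≡ Σ → (X ⟶ Y ! S) ≡ (A ⟶ B ! Σ)
cong-⟶ refl refl refl = refl

cong-⊗ : X ≡ A → Y ≡ ∏ As → X ⊗ Y ≡ ∏ (A ∷ As)
cong-⊗ refl refl = refl

cong-∷ : ∀ {g} → X ≡ A → Y ≡ B → S ≡ Σ → _≡_ {A = Sig} ((g , (X , Y)) ∷ S) ((g , (A , B)) ∷ Σ)
cong-∷ refl refl refl = refl

⟦⟧v-id  : ∀ A → ⟦ A ⟧v ≡ A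
⟦⟧vs-id : ∀ As → ⟦ As ⟧vs ≡ ∏ As
⟦⟧s-id  : ∀ Σ → ⟦ Σ ⟧s ≡ Σ
⟦⟧v-id (A ⟶ (B ! Σ)) = cong-⟶ (⟦⟧v-id A) (⟦⟧v-id B) (⟦⟧s-id Σ)
⟦⟧v-id (∏ As)        = ⟦⟧vs-id As
⟦⟧vs-id []       = refl
⟦⟧vs-id (A ∷ As) = cong-⊗ (⟦⟧v-id A) (⟦⟧vs-id As)
⟦⟧s-id []                  = refl
⟦⟧s-id ((g , (A , B)) ∷ Σ) = cong-∷ (⟦⟧v-id A) (⟦⟧v-id B) (⟦⟧s-id Σ)

-- ⟦ A ⟧v ≡ A holds only propositionally, so denotations and terms are compared along these equalities;
-- under a binder, castRen relates the term model's context ⟦ A ⟧v ∷ Γ to the syntactic A ∷ Γ.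
infix 4 _≈v[_]_ _≈c[_,_]_ _≈h[_,_,_]_

_≈v[_]_ : Val Γ X → X ≡ A → Val Γ A → Set
v ≈v[ refl ] w = v ≈v w

_≈c[_,_]_ : Comp Γ (X ! S) → X ≡ A → S ≡ Σ → Comp Γ (A ! Σ) → Set
M ≈c[ refl , refl ] N = M ≈c N

_≈h[_,_,_]_ : Hdl Γ S (X ! S′) → S ≡ Σ → X ≡ A → S′ ≡ Σ′ → Hdl Γ Σ (A ! Σ′) → Set
H ≈h[ refl , refl , refl ] K = H ≈h K

≈v[]-≈ˡ : (p : X ≡ A) {v v′ : Val Γ X} {w : Val Γ A} → v ≈v v′ → v′ ≈v[ p ] w → v ≈v[ p ] w
≈v[]-≈ˡ refl e r = trans e r

≈v[]-≈ʳ : (p : X ≡ A) {v : Val Γ X} {w w′ : Val Γ A} → v ≈v[ p ] w → w ≈v w′ → v ≈v[ p ] w′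
≈v[]-≈ʳ refl r e = trans r e

≈v[]-ren : (p : X ≡ A) (ρ : Ren Γ Δ) {v : Val Γ X} {w : Val Γ A} → v ≈v[ p ] w → renV ρ v ≈v[ p ] renV ρ w
≈v[]-ren refl ρ r = renV-resp-≈ ρ r

≈c[]-≈ˡ : (p : X ≡ A) (q : S ≡ Σ) {M M′ : Comp Γ (X ! S)} {N : Comp Γ (A ! Σ)} →
          M ≈c M′ → M′ ≈c[ p , q ] N → M ≈c[ p , q ] N
≈c[]-≈ˡ refl refl e r = trans e r

≈c[]-≡ʳ : (p : X ≡ A) (q : S ≡ Σ) {M : Comp Γ (X ! S)} {N N′ : Comp Γ (A ! Σ)} →
          M ≈c[ p , q ] N → N ≡ N′ → M ≈c[ p , q ] N′
≈c[]-≡ʳ p q r refl = r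

≈h[]-≈ˡ : (p : S ≡ Σ) (q : X ≡ A) (r : S′ ≡ Σ′) {H H′ : Hdl Γ S (X ! S′)} {K : Hdl Γ Σ (A ! Σ′)} →
          H ≈h H′ → H′ ≈h[ p , q , r ] K → H ≈h[ p , q , r ] K
≈h[]-≈ˡ refl refl refl e r = trans e r

castRen : X ≡ A → Ren (A ∷ Γ) (X ∷ Γ)
castRen p (here q)  = here (≡.trans q (≡.sym p))
castRen p (there i) = there i

castRen-refl : (i : B ∈ A ∷ Γ) → castRen refl i ≡ i
castRen-refl (here q)  = cong here (≡.trans-reflʳ q)
castRen-refl (there i) = refl

ext-castRen-refl : (i : D ∈ B ∷ A ∷ Γ) → ext (castRen refl) i ≡ i
ext-castRen-refl (here q)  = refl
ext-castRen-refl (there i) = cong there (castRen-refl i)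

x₀-compat : (p : X ≡ A) → x₀ {Γ} ≈v[ p ] var (here (≡.sym p))
x₀-compat refl = refl

ƛ-compat : (p : X ≡ A) (q : Y ≡ B) (r : S ≡ Σ) {N₁ : Comp (X ∷ Γ) (Y ! S)} {N₂ : Comp (A ∷ Γ) (B ! Σ)} →
           N₁ ≈c[ q , r ] renC (castRen p) N₂ → ƛ N₁ ≈v[ cong-⟶ p q r ] ƛ N₂
ƛ-compat refl refl refl {N₂ = N₂} e = ƛ-cong (trans e (≈c-reflexive (ren-idC castRen-refl N₂)))

·-compat : (p : X ≡ A) (q : Y ≡ B) (r : S ≡ Σ) {f : Val Γ (X ⟶ Y ! S)} {f′ : Val Γ (A ⟶ B ! Σ)}
           {a : Val Γ X} {a′ : Val Γ A} → f ≈v[ cong-⟶ p q r ] f′ → a ≈v[ p ] a′ → f · a ≈c[ q , r ] f′ · a′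
·-compat refl refl refl e e′ = ·-cong e e′

return-compat : (p : X ≡ A) (r : S ≡ Σ) {v : Val Γ X} {w : Val Γ A} →
                v ≈v[ p ] w → return v ≈c[ p , r ] return w
return-compat refl refl e = return-cong e

letin-compat : (p : X ≡ A) (q : Y ≡ B) (r : S ≡ Σ) {M₁ : Comp Γ (X ! S)} {M₂ : Comp Γ (A ! Σ)}
               {N₁ : Comp (X ∷ Γ) (Y ! S)} {N₂ : Comp (A ∷ Γ) (B ! Σ)} →
               M₁ ≈c[ p , r ] M₂ → N₁ ≈c[ q , r ] renC (castRen p) N₂ → letin M₁ N₁ ≈c[ q , r ] letin M₂ N₂
letin-compat refl refl refl {N₂ = N₂} e e′ = letin-cong e (trans e′ (≈c-reflexive (ren-idC castRen-refl N₂)))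

SameOp : ∀ {o} → S ∋ o ↦ (X , Y) → Σ ∋ o ↦ (A , B) → S ≡ Σ → X ≡ A → Y ≡ B → Set
SameOp m′ m refl refl refl = m′ ≡ m

SameOp-here : ∀ {g} (p : X ≡ A) (q : Y ≡ B) (r : S ≡ Σ) →
              SameOp {S = (g , (X , Y)) ∷ S} {Σ = (g , (A , B)) ∷ Σ} here here (cong-∷ p q r) p q
SameOp-here refl refl refl = refl

SameOp-there : ∀ {g o X′ Y′ A′ B′} (p′ : X′ ≡ A′) (q′ : Y′ ≡ B′) (r : S ≡ Σ) (p : X ≡ A) (q : Y ≡ B)
               {m′ : S ∋ o ↦ (X , Y)} {m : Σ ∋ o ↦ (A , B)} → SameOp m′ m r p q →
               SameOp {S = (g , (X′ , Y′)) ∷ S} {Σ = (g , (A′ , B′)) ∷ Σ} (there m′) (there m) (cong-∷ p′ q′ r) p q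
SameOp-there refl refl refl refl refl e = cong there e

⟦⟧op-SameOp : ∀ {Σ o A B} (m : Σ ∋ o ↦ (A , B)) → SameOp ⟦ m ⟧op m (⟦⟧s-id Σ) (⟦⟧v-id A) (⟦⟧v-id B)
⟦⟧op-SameOp {Σ = (g , (A , B)) ∷ Σ} here = SameOp-here (⟦⟧v-id A) (⟦⟧v-id B) (⟦⟧s-id Σ)
⟦⟧op-SameOp {Σ = (g , (A′ , B′)) ∷ Σ} {A = A} {B} (there m) =
  SameOp-there (⟦⟧v-id A′) (⟦⟧v-id B′) (⟦⟧s-id Σ) (⟦⟧v-id A) (⟦⟧v-id B) (⟦⟧op-SameOp m)

opcall-compat : ∀ {o} (r : S ≡ Σ) (p : X ≡ A) (q : Y ≡ B) {m′ : S ∋ o ↦ (X , Y)} {m : Σ ∋ o ↦ (A , B)}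
                {v : Val Γ X} {w : Val Γ A} → SameOp m′ m r p q → v ≈v[ p ] w → opcall m′ v ≈c[ q , r ] opcall m w
opcall-compat refl refl refl refl e = opcall-cong _ e

handle-compat : (pA : X ≡ A) (pΣ : S ≡ Σ) (pB : Y ≡ B) (pΣ′ : S′ ≡ Σ′)
                {M₁ : Comp Γ (X ! S)} {M₂ : Comp Γ (A ! Σ)} {H₁ : Hdl Γ S (Y ! S′)} {H₂ : Hdl Γ Σ (B ! Σ′)}
                {N₁ : Comp (X ∷ Γ) (Y ! S′)} {N₂ : Comp (A ∷ Γ) (B ! Σ′)} →
                M₁ ≈c[ pA , pΣ ] M₂ → H₁ ≈h[ pΣ , pB , pΣ′ ] H₂ → N₁ ≈c[ pB , pΣ′ ] renC (castRen pA) N₂ →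
                (handle M₁ by H₁ to N₁) ≈c[ pB , pΣ′ ] (handle M₂ by H₂ to N₂)
handle-compat refl refl refl refl {N₂ = N₂} e e′ e″ =
  handle-cong e e′ (trans e″ (≈c-reflexive (ren-idC castRen-refl N₂)))

[]-compat : (q : Y ≡ B) (r : S′ ≡ Σ′) → [] {Γ} ≈h[ refl , q , r ] []
[]-compat refl refl = refl

clause-compat : ∀ {g X′ Y′} (pA : X′ ≡ A) (pB : Y′ ≡ B) (pΣ : S ≡ Σ) (pX : X ≡ D) (pΣ′ : S′ ≡ Σ′)
                {N₁ : Comp ((Y′ ⟶ X ! S′) ∷ X′ ∷ Γ) (X ! S′)} {N₂ : Comp ((B ⟶ D ! Σ′) ∷ A ∷ Γ) (D ! Σ′)}
                {H₁ : Hdl Γ S (X ! S′)} {H₂ : Hdl Γ Σ (D ! Σ′)} →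
                N₁ ≈c[ pX , pΣ′ ] renC (castRen (cong-⟶ pB pX pΣ′)) (renC (ext (castRen pA)) N₂) →
                H₁ ≈h[ pΣ , pX , pΣ′ ] H₂ →
                clause {g = g} N₁ H₁ ≈h[ cong-∷ pA pB pΣ , pX , pΣ′ ] clause N₂ H₂
clause-compat refl refl refl refl refl {N₂ = N₂} e e′ =
  clause-cong (trans e (≈c-reflexive (≡.trans (ren-idC castRen-refl _) (ren-idC ext-castRen-refl N₂)))) e′

∷-compat : (p : X ≡ A) (q : Y ≡ ∏ As) {a : Val Γ X} {b : Val Γ Y} {w : Val Γ A} {ws : Vals Γ As} →
           a ≈v[ p ] w → b ≈v[ q ] ⟪ ws ⟫ → pair a b ≈v[ cong-⊗ p q ] ⟪ w ∷ ws ⟫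
∷-compat refl refl e e′ = trans (pair-cong e e′) (pair-⟪⟫ _ _)

fst-compat : (p : X ≡ A) (q : Y ≡ ∏ As) {v : Val Γ (X ⊗ Y)} {w : Val Γ (∏ (A ∷ As))} →
             v ≈v[ cong-⊗ p q ] w → fst {B = Y} v ≈v[ p ] proj (here refl) w
fst-compat refl refl e = proj-cong _ e

snd-compat : (p : X ≡ A) (q : Y ≡ ∏ As) {v : Val Γ (X ⊗ Y)} {w : Val Γ (∏ (A ∷ As))} →
             v ≈v[ cong-⊗ p q ] w → snd {B = Y} v ≈v[ q ] ⟪ tabulateVs As (λ j → proj (there j) w) ⟫
snd-compat {As = As} refl refl e = ⟪⟫-cong (tabulateVs-cong As (λ j → proj-cong _ e))

proj-compat : (i : A ∈ As) {v : Val Γ ⟦ As ⟧vs} {w : Val Γ (∏ As)} →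
              v ≈v[ ⟦⟧vs-id As ] w → fun ⟦ i ⟧proj v ≈v[ ⟦⟧v-id A ] proj i w
proj-compat {As = A ∷ As} (here refl) e = fst-compat (⟦⟧v-id A) (⟦⟧vs-id As) e
proj-compat {A = A} {As = A′ ∷ As} (there i) {w = w} e =
  ≈v[]-≈ʳ (⟦⟧v-id A) (proj-compat i (snd-compat (⟦⟧v-id A′) (⟦⟧vs-id As) e))
    (trans (∏-β i _) (≈v-reflexive (lookupVs-tabulateVs As (λ j → proj (there j) w) i)))

force-⟦letin⟧ : (M : Comp Γ (A ! Σ)) (N : Comp (A ∷ Γ) (B ! Σ)) (γ : Val Δ ⟦ Γ ⟧ctx) →
                force (fun ⟦ letin M N ⟧M γ)
                  ≈c letin (force (fun ⟦ M ⟧M γ)) (force (fun ⟦ N ⟧M (pair (wk γ) x₀)))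
force-⟦letin⟧ {Σ = Σ} M N γ = force-μ (force-T₁-st ⟦ N ⟧M γ (fun ⟦ M ⟧M γ))
  where open TermMonad ⟦ Σ ⟧s

force-⟦handle⟧ : (M : Comp Γ (A ! Σ)) (H : Hdl Γ Σ (X ! Σ′)) (N : Comp (A ∷ Γ) (X ! Σ′))
                 (γ : Val Δ ⟦ Γ ⟧ctx) →
                 force (fun ⟦ handle M by H to N ⟧M γ)
                   ≈c (handle force (fun ⟦ M ⟧M γ) by hdlOf ⟦ Σ ⟧s (fun ⟦ H ⟧H γ)
                       to force (fun ⟦ N ⟧M (pair (wk γ) x₀)))
force-⟦handle⟧ {Σ = Σ} {X = X} {Σ′} M H N γ =
  trans (force-handle _ (fst-pair hγ t)
                      (trans (force-cong (snd-pair hγ t)) (force-T₁-st ⟦ N ⟧M γ (fun ⟦ M ⟧M γ))))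
        (handle-let-return _ _ _ _)
  where
  open TermMonad ⟦ Σ ⟧s
  open TermHandle ⟦ Σ ⟧s ⟦ Σ′ ⟧s ⟦ X ⟧v
  hγ = fun ⟦ H ⟧H γ
  t = fun (T₁H ⟦ N ⟧M) (fun stH (pair γ (fun ⟦ M ⟧M γ)))

hdlOf-⟦clause⟧ : ∀ {g} (M : Comp ((B ⟶ X ! Σ′) ∷ A ∷ Γ) (X ! Σ′)) (H : Hdl Γ Σ (X ! Σ′))
                 (γ : Val Δ ⟦ Γ ⟧ctx) →
                 hdlOf ⟦ (g , (A , B)) ∷ Σ ⟧s (fun ⟦ clause {g = g} M H ⟧H γ)
                   ≈h clause (force (fun ⟦ M ⟧M (pair (wk (pair (wk γ) x₀)) x₀)))
                             (hdlOf ⟦ Σ ⟧s (fun ⟦ H ⟧H γ))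
hdlOf-⟦clause⟧ {B = B} {X = X} {Σ′ = Σ′} {A = A} {Γ = Γ} {Σ = Σ} {Δ = Δ} M H γ =
  clause-cong body (hdlOf-cong ⟦ Σ ⟧s (snd-pair ℓ hγ))
  where
  open TermMonad ⟦ Σ′ ⟧s using (ΛH; ΛH-β)
  open ≈c-Reasoning
  K : VTy
  K = ⟦ B ⟧v ⟶ ⟦ X ⟧v ! ⟦ Σ′ ⟧s
  reassoc : Hom (⟦ Γ ⟧ctx ⊗ (⟦ A ⟧v ⊗ K)) ((⟦ Γ ⟧ctx ⊗ ⟦ A ⟧v) ⊗ K)
  reassoc = ⟨ ⟨ fstH {B = ⟦ A ⟧v ⊗ K} , fstH {B = K} ∘H sndH {⟦ Γ ⟧ctx} {⟦ A ⟧v ⊗ K} ⟩H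
            , sndH {⟦ A ⟧v} {K} ∘H sndH {⟦ Γ ⟧ctx} {⟦ A ⟧v ⊗ K} ⟩H
  L : Hom ⟦ Γ ⟧ctx (⟦ A ⟧v ⊗ K ⟶ ⟦ X ⟧v ! ⟦ Σ′ ⟧s)
  L = ΛH (⟦ M ⟧M ∘H reassoc)
  ℓ : Val Δ (⟦ A ⟧v ⊗ K ⟶ ⟦ X ⟧v ! ⟦ Σ′ ⟧s)
  ℓ = fun L γ
  hγ : Val Δ (Hobj ⟦ Σ ⟧s ⟦ Σ′ ⟧s ⟦ X ⟧v)
  hγ = fun ⟦ H ⟧H γ
  u : Val (K ∷ ⟦ A ⟧v ∷ Δ) ⟦ Γ ⟧ctx
  u = wk (wk γ)

  fst-wk-wk : fst {B = Hobj ⟦ Σ ⟧s ⟦ Σ′ ⟧s ⟦ X ⟧v} (wk (wk (pair ℓ hγ))) ≈v fun L u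
  fst-wk-wk = trans (sym (nat-wk-wk fstH (pair ℓ hγ)))
                    (trans (renV-resp-≈ there (renV-resp-≈ there (fst-pair ℓ hγ))) (nat-wk-wk L γ))

  x₁x₀ : Val (K ∷ ⟦ A ⟧v ∷ Δ) (⟦ A ⟧v ⊗ K)
  x₁x₀ = pair x₁ x₀

  reassoc-pair : fun reassoc (pair u x₁x₀) ≈v pair (pair u x₁) x₀
  reassoc-pair = pair-cong (pair-cong (fst-pair u x₁x₀)
                                      (trans (fst-cong {B = K} (snd-pair u x₁x₀)) (fst-pair x₁ x₀)))
                           (trans (snd-cong {B = K} (snd-pair u x₁x₀)) (snd-pair x₁ x₀))

  body : fst {B = Hobj ⟦ Σ ⟧s ⟦ Σ′ ⟧s ⟦ X ⟧v} (wk (wk (pair ℓ hγ))) · x₁x₀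
           ≈c force (fun ⟦ M ⟧M (pair (wk (pair (wk γ) x₀)) x₀))
  body = begin
    fst (wk (wk (pair ℓ hγ))) · x₁x₀                        ≈⟨ ·-cong fst-wk-wk refl ⟩
    fun L u · x₁x₀                                          ≈⟨ ΛH-β (⟦ M ⟧M ∘H reassoc) u x₁x₀ ⟩
    force (fun ⟦ M ⟧M (fun reassoc (pair u x₁x₀)))          ≈⟨ force-cong (resp ⟦ M ⟧M reassoc-pair) ⟩
    force (fun ⟦ M ⟧M (pair (pair u x₁) x₀))                ≡⟨ cong (λ v → force (fun ⟦ M ⟧M (pair v x₀)))
                                                                    (≡.sym (ren-pair there (wk γ) x₀)) ⟩
    force (fun ⟦ M ⟧M (pair (wk (pair (wk γ) x₀)) x₀))      ∎

Env : Val Δ ⟦ Γ ⟧ctx → Sub Γ Δ → Set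
Env {Γ = Γ} γ σ = ∀ {A} (i : A ∈ Γ) → fun ⟦ i ⟧var γ ≈v[ ⟦⟧v-id A ] σ i

Env-ext : {γ : Val Δ ⟦ Γ ⟧ctx} {σ : Sub Γ Δ} → Env γ σ →
          Env (pair {B = ⟦ A ⟧v} (wk γ) x₀) (castRen (⟦⟧v-id A) ᵣ∘ₛ exts σ)
Env-ext {A = A} {γ = γ} e (here refl) = ≈v[]-≈ˡ (⟦⟧v-id A) (snd-pair (wk γ) x₀) (x₀-compat (⟦⟧v-id A))
Env-ext {A = A} {γ = γ} {σ} e {B} (there i) =
  ≈v[]-≈ˡ (⟦⟧v-id B) (trans (resp ⟦ i ⟧var (fst-pair (wk γ) x₀)) (sym (nat-ren ⟦ i ⟧var there γ)))
    (≡.subst (_ ≈v[ ⟦⟧v-id B ]_) (≡.sym (ren-renV (λ _ → refl) (σ i))) (≈v[]-ren (⟦⟧v-id B) there (e i)))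

interp≈subV  : (V : Val Γ A) {γ : Val Δ ⟦ Γ ⟧ctx} {σ : Sub Γ Δ} → Env γ σ →
               fun ⟦ V ⟧V γ ≈v[ ⟦⟧v-id A ] subV σ V
interp≈subVs : (Vs : Vals Γ As) {γ : Val Δ ⟦ Γ ⟧ctx} {σ : Sub Γ Δ} → Env γ σ →
               fun ⟦ Vs ⟧Vs γ ≈v[ ⟦⟧vs-id As ] ⟪ subVs σ Vs ⟫
interp≈subC  : (M : Comp Γ (B ! Σ)) {γ : Val Δ ⟦ Γ ⟧ctx} {σ : Sub Γ Δ} → Env γ σ →
               force (fun ⟦ M ⟧M γ) ≈c[ ⟦⟧v-id B , ⟦⟧s-id Σ ] subC σ M
interp≈subH  : (H : Hdl Γ Σ (X ! Σ′)) {γ : Val Δ ⟦ Γ ⟧ctx} {σ : Sub Γ Δ} → Env γ σ →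
               hdlOf ⟦ Σ ⟧s (fun ⟦ H ⟧H γ) ≈h[ ⟦⟧s-id Σ , ⟦⟧v-id X , ⟦⟧s-id Σ′ ] subH σ H

interp≈subC-ext : (M : Comp (A ∷ Γ) (B ! Σ)) {γ : Val Δ ⟦ Γ ⟧ctx} {σ : Sub Γ Δ} → Env γ σ →
                  force (fun ⟦ M ⟧M (pair (wk γ) x₀))
                    ≈c[ ⟦⟧v-id B , ⟦⟧s-id Σ ] renC (castRen (⟦⟧v-id A)) (subC (exts σ) M)
interp≈subC-ext {B = B} {Σ = Σ} M e =
  ≈c[]-≡ʳ (⟦⟧v-id B) (⟦⟧s-id Σ) (interp≈subC M (Env-ext e)) (≡.sym (ren-subC (λ _ → refl) M))

interp≈subV (var i) e = e i
interp≈subV (ƛ {A = A} {C = B ! Σ} M) e =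
  ƛ-compat (⟦⟧v-id A) (⟦⟧v-id B) (⟦⟧s-id Σ) (interp≈subC-ext M e)
interp≈subV ⟪ Vs ⟫ e = interp≈subVs Vs e
interp≈subV (proj i V) e = proj-compat i (interp≈subV V e)
interp≈subVs [] e = refl
interp≈subVs (_∷_ {A = A} {As} V Vs) e =
  ∷-compat (⟦⟧v-id A) (⟦⟧vs-id As) (interp≈subV V e) (interp≈subVs Vs e)

interp≈subC {B = B} {Σ} (_·_ {A = A} V W) {γ = γ} e =
  ≈c[]-≈ˡ (⟦⟧v-id B) (⟦⟧s-id Σ)
    (trans (force-thunk _) (·-cong (fst-pair (fun ⟦ V ⟧V γ) (fun ⟦ W ⟧V γ))
                                   (snd-pair (fun ⟦ V ⟧V γ) (fun ⟦ W ⟧V γ))))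
    (·-compat (⟦⟧v-id A) (⟦⟧v-id B) (⟦⟧s-id Σ) (interp≈subV V e) (interp≈subV W e))
interp≈subC {B = B} {Σ} (return V) e =
  ≈c[]-≈ˡ (⟦⟧v-id B) (⟦⟧s-id Σ) (force-thunk _) (return-compat (⟦⟧v-id B) (⟦⟧s-id Σ) (interp≈subV V e))
interp≈subC {B = B} {Σ} (letin {A = A} M N) {γ = γ} e =
  ≈c[]-≈ˡ (⟦⟧v-id B) (⟦⟧s-id Σ) (force-⟦letin⟧ M N γ)
    (letin-compat (⟦⟧v-id A) (⟦⟧v-id B) (⟦⟧s-id Σ) (interp≈subC M e) (interp≈subC-ext N e))
interp≈subC {B = B} {Σ} (opcall {A = A} m V) e =
  ≈c[]-≈ˡ (⟦⟧v-id B) (⟦⟧s-id Σ) (force-thunk _)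
    (opcall-compat (⟦⟧s-id Σ) (⟦⟧v-id A) (⟦⟧v-id B) (⟦⟧op-SameOp m) (interp≈subV V e))
interp≈subC {B = X} {Σ′} (handle_by_to_ {A = A} {Σ = Σ} M H N) {γ = γ} e =
  ≈c[]-≈ˡ (⟦⟧v-id X) (⟦⟧s-id Σ′) (force-⟦handle⟧ M H N γ)
    (handle-compat (⟦⟧v-id A) (⟦⟧s-id Σ) (⟦⟧v-id X) (⟦⟧s-id Σ′)
       (interp≈subC M e) (interp≈subH H e) (interp≈subC-ext N e))

interp≈subH {X = X} {Σ′} [] e = []-compat (⟦⟧v-id X) (⟦⟧s-id Σ′)
interp≈subH {X = X} {Σ′} (clause {A = A} {B} {Σ} M H) {γ = γ} {σ} e =
  ≈h[]-≈ˡ (⟦⟧s-id ((_ , (A , B)) ∷ Σ)) (⟦⟧v-id X) (⟦⟧s-id Σ′) (hdlOf-⟦clause⟧ M H γ)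
    (clause-compat (⟦⟧v-id A) (⟦⟧v-id B) (⟦⟧s-id Σ) (⟦⟧v-id X) (⟦⟧s-id Σ′)
       (≈c[]-≡ʳ (⟦⟧v-id X) (⟦⟧s-id Σ′) (interp≈subC M (Env-ext (Env-ext e))) (≡.sym under-two-binders))
       (interp≈subH H e))
  where
  pK = ⟦⟧v-id (B ⟶ X ! Σ′)
  pA = ⟦⟧v-id A
  under-two-binders : renC (castRen pK) (renC (ext (castRen pA)) (subC (exts (exts σ)) M))
                        ≡ subC (castRen pK ᵣ∘ₛ exts (castRen pA ᵣ∘ₛ exts σ)) M
  under-two-binders = ≡.trans (cong (renC (castRen pK)) (ren-subC (ren-sub-ext (λ _ → refl)) M))
                              (ren-subC (λ _ → refl) M)

idEnv : ∀ Γ → Val Γ ⟦ Γ ⟧ctx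
idEnv []      = unit
idEnv (A ∷ Γ) = pair {B = ⟦ A ⟧v} (wk (idEnv Γ)) (var (here (⟦⟧v-id A)))

var-compat : (p : X ≡ A) → var {Γ = A ∷ Γ} (here p) ≈v[ p ] var (here refl)
var-compat refl = refl

Env-id : ∀ Γ → Env (idEnv Γ) var
Env-id (A ∷ Γ) (here refl) =
  ≈v[]-≈ˡ (⟦⟧v-id A) (snd-pair (wk (idEnv Γ)) (var (here (⟦⟧v-id A)))) (var-compat (⟦⟧v-id A))
Env-id (A ∷ Γ) {B} (there i) =
  ≈v[]-≈ˡ (⟦⟧v-id B) (trans (resp ⟦ i ⟧var (fst-pair (wk (idEnv Γ)) (var (here (⟦⟧v-id A)))))
                            (sym (nat-ren ⟦ i ⟧var there (idEnv Γ))))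
    (≈v[]-ren (⟦⟧v-id B) there (Env-id Γ i))

≈v[]-functional : (p : X ≡ A) {a b : Val Γ X} {V W : Val Γ A} → a ≈v[ p ] V → a ≈v b → b ≈v[ p ] W → V ≈v W
≈v[]-functional refl r e r′ = trans (sym r) (trans e r′)

≈c[]-functional : (p : X ≡ A) (q : S ≡ Σ) {a b : Comp Γ (X ! S)} {M N : Comp Γ (A ! Σ)} →
              a ≈c[ p , q ] M → a ≈c b → b ≈c[ p , q ] N → M ≈c N
≈c[]-functional refl refl r e r′ = trans (sym r) (trans e r′)

≈h[]-functional : (p : S ≡ Σ) (q : X ≡ A) (r : S′ ≡ Σ′) {a b : Hdl Γ S (X ! S′)} {H K : Hdl Γ Σ (A ! Σ′)} →
              a ≈h[ p , q , r ] H → a ≈h b → b ≈h[ p , q , r ] K → H ≈h K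
≈h[]-functional refl refl refl r e r′ = trans (sym r) (trans e r′)

complete-V : (V W : Val Γ A) → ValidV V W → V ≈v W
complete-V {Γ} {A} V W valid =
  ≈v[]-functional (⟦⟧v-id A) (at V) (valid TermPreModel TermModel (idEnv Γ)) (at W)
  where
  at : (U : Val Γ A) → fun ⟦ U ⟧V (idEnv Γ) ≈v[ ⟦⟧v-id A ] U
  at U = ≈v[]-≈ʳ (⟦⟧v-id A) (interp≈subV U (Env-id Γ)) (≈v-reflexive (sub-idV (λ _ → refl) U))

complete-C : (M N : Comp Γ C) → ValidC M N → M ≈c N
complete-C {Γ} {B ! Σ} M N valid =
  ≈c[]-functional (⟦⟧v-id B) (⟦⟧s-id Σ) (at M) (force-cong (valid TermPreModel TermModel (idEnv Γ))) (at N)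
  where
  at : (L : Comp Γ (B ! Σ)) → force (fun ⟦ L ⟧M (idEnv Γ)) ≈c[ ⟦⟧v-id B , ⟦⟧s-id Σ ] L
  at L = ≈c[]-≡ʳ (⟦⟧v-id B) (⟦⟧s-id Σ) (interp≈subC L (Env-id Γ)) (sub-idC (λ _ → refl) L)

complete-H : (H K : Hdl Γ Σ C) → ValidH H K → H ≈h K
complete-H {Γ} {Σ} {X ! Σ′} H K valid =
  ≈h[]-functional (⟦⟧s-id Σ) (⟦⟧v-id X) (⟦⟧s-id Σ′) (at H)
    (hdlOf-cong ⟦ Σ ⟧s (valid TermPreModel TermModel (idEnv Γ))) (at K)
  where
  at : (L : Hdl Γ Σ (X ! Σ′)) →
       hdlOf ⟦ Σ ⟧s (fun ⟦ L ⟧H (idEnv Γ)) ≈h[ ⟦⟧s-id Σ , ⟦⟧v-id X , ⟦⟧s-id Σ′ ] L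
  at L = ≡.subst (hdlOf ⟦ Σ ⟧s (fun ⟦ L ⟧H (idEnv Γ)) ≈h[ ⟦⟧s-id Σ , ⟦⟧v-id X , ⟦⟧s-id Σ′ ]_)
                 (sub-idH (λ _ → refl) L) (interp≈subH L (Env-id Γ))

theorem4p9 :
    (∀ {Γ A} (V W : Val Γ A) → ValidV V W → V ≈v W)
    × (∀ {Γ C} (M N : Comp Γ C) → ValidC M N → M ≈c N)
    × (∀ {Γ Σ C} (H K : Hdl Γ Σ C) → ValidH H K → H ≈h K)
theorem4p9 = complete-V , complete-C , complete-H
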